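{- Let $n\ge 6$ and let $\mathcal F=\{A\subseteq[n]:\ A\neq\emptyset\text{ and for every }i\in A,\ i-1\in A\text{ or }i+1\in A\}$ (the union-closed family generated by $\{\{1,2\},\{2,3\},\dots,\{n-1,n\}\}$). Then $\mathcal F$ is $(n-1)$-dense.
   Context: A family of subsets of $[n]$ is union-closed over $[n]$ if it contains $[n]$ and is closed under pairwise unions. Convention: the empty set is never a member of any family considered; $2^{[n]}$ denotes the family of all nonempty subsets of $[n]$. The closure of a union-closed $\mathcal F$ is $\overline{\mathcal F}=\{A\in 2^{[n]}:\ \mathcal F\cup\{A\}\text{ is union-closed}\}$; iterated closures are $\overline{\mathcal F}^{(0)}=\mathcal F$, $\overline{\mathcal F}^{(i)}=\overline{\overline{\mathcal F}^{(i-1)}}$. $\mathcal F$ is $k$-dense if $k$ is the smallest nonnegative integer with $\overline{\mathcal F}^{(k)}=2^{[n]}$. -}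

module Defs where

open import Data.Nat using (ℕ; zero; suc; _+_; _<_)
open import Data.Fin using (Fin; toℕ)
open import Data.Fin.Subset using (Subset; _∈_; _∪_; ⊤; Nonempty)
open import Data.Product using (_×_; ∃; Σ)
open import Data.Sum using (_⊎_)
open import Relation.Nullary using (¬_)
open import Relation.Binary.PropositionalEquality using (_≡_)

-- A family of subsets of [n] = {0,…,n-1}, as a membership predicate.
Family : ℕ → Set₁
Family n = Subset n → Set

_∪｛_｝ : ∀ {n} → Family n → Subset n → Family n
(F ∪｛ A ｝) B = F B ⊎ B ≡ A

UnionClosed : ∀ {n} → Family n → Set
UnionClosed F = F ⊤ × (∀ B C → F B → F C → F (B ∪ C))

-- 2^[n]: all nonempty subsets of [n]
AllNonempty : ∀ n → Family n
AllNonempty n A = Nonempty A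

closure : ∀ {n} → Family n → Family n
closure F A = Nonempty A × UnionClosed (F ∪｛ A ｝)

closureIter : ∀ {n} → ℕ → Family n → Family n
closureIter zero    F = F
closureIter (suc i) F = closure (closureIter i F)

_≋_ : ∀ {n} → Family n → Family n → Set
F ≋ G = ∀ A → (F A → G A) × (G A → F A)

IsDense : ∀ {n} → Family n → ℕ → Set
IsDense {n} F k =
  (closureIter k F ≋ AllNonempty n) × (∀ j → j < k → ¬ (closureIter j F ≋ AllNonempty n))

Adjacent : ∀ {n} → Fin n → Fin n → Set
Adjacent i j = toℕ j + 1 ≡ toℕ i ⊎ toℕ i + 1 ≡ toℕ j

pathFamily : ∀ n → Family n
pathFamily n A = Nonempty A × (∀ i → i ∈ A → ∃ λ j → Adjacent i j × j ∈ A)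

module Submission where

-- Every G k is union-closed and G k ⊆ G (k+1), so a set A enters G (k+1)
-- exactly when A ∪ B ∈ G k for every B ∈ G k bringing a point new to A (the
-- lower step); in particular a nonempty set missing at most k positions lies
-- in G k, whence G (n-1) contains every nonempty set.
--
-- For the sharpness we measure an isolated point i of A by its cost: the
-- number of positions missing from A plus a weight, which is 3 at the ends
-- of [n], 2 next to them and otherwise the number of sides of i on which A
-- has points.  For k + 4 ≤ n we show
--   * upper bound: if an isolated point i of A costs more than k + 3 then
--     A ∉ G k, by induction on k: a suitable pair B ∈ F (an "escape") adds a
--     new point while i stays isolated in A ∪ B at cost more than k + 2, so
--     the upper step applies;
--   * lower bound: if all isolated points of a nonempty A cost at most k + 3
--     then A ∈ G k, because this bound is preserved by unions with members
--     of G (k-1), which obey it one level lower by the upper bound.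
-- Then {3} ∈ G (n-4) while 0 is isolated in {0,3,4} at cost n, and two
-- upper steps show {0} ∉ G (n-2).

open import Defs
open import Data.Nat using (ℕ; _≤_; _∸_)
open import Data.Nat using (zero; suc; _+_; _<_; z≤n; s≤s; pred; _≡ᵇ_; _≟_)
open import Data.Nat.Properties
open import Data.Bool using (Bool; true; false; _∨_; T)
open import Data.Bool.Properties using (∨-zeroʳ; ¬-not)
import Data.Bool.Properties as Bool
open import Data.Vec using ([]; _∷_)
open import Data.Fin using (Fin; toℕ; fromℕ<) renaming (zero to fzero; suc to fsuc)
open import Data.Fin.Properties using (toℕ-fromℕ<)
open import Data.Fin.Subset using (Subset; _∈_; _∪_; ⊤; Nonempty) renaming (⊥ to ∅)
open import Data.Fin.Subset.Properties using (∪-assoc; ∪-comm; ∪-idem; ∪-identityˡ; ∪-identityʳ)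
open import Data.Vec.Base using (here; there)
open import Data.List using (List; []; _∷_; length)
open import Data.List.Membership.Propositional using () renaming (_∈_ to _∈ₗ_)
open import Data.List.Relation.Unary.Any using (here; there)
open import Data.List.Relation.Unary.All using (All; []; _∷_; lookup; tabulate)
open import Data.List.Relation.Unary.AllPairs using ([]; _∷_)
import Data.List.Relation.Unary.AllPairs as AllPairs
open import Data.List.Relation.Unary.Linked using (Linked; []; [-]; _∷_)
open import Data.List.Relation.Unary.Linked.Properties using (Linked⇒AllPairs)
open import Data.List.Relation.Unary.Unique.Propositional using (Unique)
open import Data.Product using (∃; _×_; _,_; proj₁; proj₂)
open import Data.Sum using (_⊎_; inj₁; inj₂; [_,_]′)
open import Data.Empty using (⊥; ⊥-elim)
open import Data.Unit using (tt)
open import Relation.Nullary using (¬_; Dec; yes; no)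
open import Relation.Nullary.Decidable using (_×-dec_; _⊎-dec_; ¬?)
open import Relation.Binary.PropositionalEquality
open import Relation.Binary.Definitions using (tri<; tri≈; tri>)
open import Data.Nat.Tactic.RingSolver using (solve-∀)
open import Function using (_∘_)

-- Positions of a subset of [n] are handled as natural numbers: mem A m tells
-- whether m ∈ A (positions ≥ n are never members).  This makes the
-- arithmetic on neighbours i-1, i+1 painless.

mem : ∀ {n} → Subset n → ℕ → Bool
mem []      _       = false
mem (b ∷ A) zero    = b
mem (b ∷ A) (suc m) = mem A m

infix 4 _⊑_
_⊑_ : ∀ {n} → Subset n → Subset n → Set
A ⊑ B = ∀ m → mem A m ≡ true → mem B m ≡ true

true≢false : ∀ {b} → b ≡ true → b ≡ false → ⊥
true≢false refl ()

¬true⇒false : ∀ {b} → ¬ (b ≡ true) → b ≡ false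
¬true⇒false = ¬-not

¬false⇒true : ∀ {b} → ¬ (b ≡ false) → b ≡ true
¬false⇒true = ¬-not

boolCases : (b : Bool) → b ≡ true ⊎ b ≡ false
boolCases true  = inj₁ refl
boolCases false = inj₂ refl

mem-∪ : ∀ {n} (A B : Subset n) m → mem (A ∪ B) m ≡ mem A m ∨ mem B m
mem-∪ []      []      m       = refl
mem-∪ (a ∷ A) (b ∷ B) zero    = refl
mem-∪ (a ∷ A) (b ∷ B) (suc m) = mem-∪ A B m

∪-split : ∀ {n} (A B : Subset n) m → mem (A ∪ B) m ≡ true → mem A m ≡ true ⊎ mem B m ≡ true
∪-split A B m e with mem A m | mem-∪ A B m
... | true  | _  = inj₁ refl
... | false | eq = inj₂ (trans (sym eq) e)

∪-outside : ∀ {n} (A B : Subset n) m → mem A m ≡ false → mem B m ≡ false → mem (A ∪ B) m ≡ false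
∪-outside A B m a b rewrite mem-∪ A B m | a | b = refl

⊑-∪ˡ : ∀ {n} (A B : Subset n) → A ⊑ A ∪ B
⊑-∪ˡ A B m e rewrite mem-∪ A B m | e = refl

⊑-∪ʳ : ∀ {n} (A B : Subset n) → B ⊑ A ∪ B
⊑-∪ʳ A B m e rewrite mem-∪ A B m | e = ∨-zeroʳ (mem A m)

⊑-lub : ∀ {n} (A B : Subset n) {C : Subset n} → A ⊑ C → B ⊑ C → A ∪ B ⊑ C
⊑-lub A B ac bc m e = [ ac m , bc m ]′ (∪-split A B m e)

mem⇒< : ∀ {n} (A : Subset n) m → mem A m ≡ true → m < n
mem⇒< (b ∷ A) zero    e = s≤s z≤n
mem⇒< (b ∷ A) (suc m) e = s≤s (mem⇒< A m e)

∈⇒mem : ∀ {n} {A : Subset n} {x} → x ∈ A → mem A (toℕ x) ≡ true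
∈⇒mem here      = refl
∈⇒mem (there h) = ∈⇒mem h

mem⇒∈ : ∀ {n} (A : Subset n) (x : Fin n) → mem A (toℕ x) ≡ true → x ∈ A
mem⇒∈ (true ∷ A) fzero    refl = here
mem⇒∈ (b ∷ A)    (fsuc x) e    = there (mem⇒∈ A x e)

mem⇒∈′ : ∀ {n} (A : Subset n) m (m<n : m < n) → mem A m ≡ true → fromℕ< m<n ∈ A
mem⇒∈′ A m m<n e = mem⇒∈ A (fromℕ< m<n) (subst (λ z → mem A z ≡ true) (sym (toℕ-fromℕ< m<n)) e)

mem-ext : ∀ {n} (A B : Subset n) → (∀ m → mem A m ≡ mem B m) → A ≡ B
mem-ext []      []      h = refl
mem-ext (a ∷ A) (b ∷ B) h = cong₂ _∷_ (h 0) (mem-ext A B (λ m → h (suc m)))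

nonempty⇒mem : ∀ {n} {A : Subset n} → Nonempty A → ∃ λ m → mem A m ≡ true
nonempty⇒mem (x , h) = toℕ x , ∈⇒mem h

mem⇒nonempty : ∀ {n} (A : Subset n) m → mem A m ≡ true → Nonempty A
mem⇒nonempty A m e = fromℕ< (mem⇒< A m e) , mem⇒∈′ A m (mem⇒< A m e) e

search : (P : ℕ → Set) → (∀ m → Dec (P m)) → ∀ n → (∃ λ m → m < n × P m) ⊎ (∀ m → m < n → ¬ P m)
search P P? zero    = inj₂ (λ m ())
search P P? (suc n) with search P P? n | P? n
... | inj₁ (m , m<n , p) | _     = inj₁ (m , m≤n⇒m≤1+n m<n , p)
... | inj₂ none          | yes p = inj₁ (n , ≤-refl , p)
... | inj₂ none          | no ¬p = inj₂ below
  where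
    below : ∀ m → m < suc n → ¬ P m
    below m m<1+n pm with m ≟ n
    ... | yes refl = ¬p pm
    ... | no m≢n   = none m (≤∧≢⇒< (≤-pred m<1+n) m≢n) pm

member? : ∀ {n} (C : Subset n) (P : ℕ → Set) → (∀ t → Dec (P t)) →
  (∃ λ t → mem C t ≡ true × P t) ⊎ (∀ t → mem C t ≡ true → ¬ P t)
member? {n} C P P? with search (λ t → mem C t ≡ true × P t) (λ t → (mem C t Bool.≟ true) ×-dec P? t) n
... | inj₁ (t , _ , found) = inj₁ (t , found)
... | inj₂ none            = inj₂ (λ t tC pt → none t (mem⇒< C t tC) (tC , pt))

⊑-or-new : ∀ {n} (A B : Subset n) → B ⊑ A ⊎ (∃ λ x → mem B x ≡ true × mem A x ≡ false)
⊑-or-new A B with member? B (λ x → mem A x ≡ false) (λ x → mem A x Bool.≟ false)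
... | inj₁ new  = inj₂ new
... | inj₂ none = inj₁ (λ m mB → ¬false⇒true (none m mB))

⊑⇒∪≡ : ∀ {n} (A B : Subset n) → B ⊑ A → A ∪ B ≡ A
⊑⇒∪≡ A B B⊑A = mem-ext (A ∪ B) A same
  where
    same : ∀ m → mem (A ∪ B) m ≡ mem A m
    same m rewrite mem-∪ A B m with mem A m in ea | mem B m in eb
    ... | true  | _     = refl
    ... | false | false = refl
    ... | false | true  = ⊥-elim (true≢false (B⊑A m eb) ea)

miss : ∀ {n} → Subset n → ℕ
miss []          = 0
miss (true ∷ A)  = miss A
miss (false ∷ A) = suc (miss A)

miss-mono : ∀ {n} (A B : Subset n) → A ⊑ B → miss B ≤ miss A
miss-mono []          []          A⊑B = z≤n
miss-mono (true ∷ A)  (true ∷ B)  A⊑B = miss-mono A B (λ m → A⊑B (suc m))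
miss-mono (true ∷ A)  (false ∷ B) A⊑B with A⊑B 0 refl
... | ()
miss-mono (false ∷ A) (true ∷ B)  A⊑B = m≤n⇒m≤1+n (miss-mono A B (λ m → A⊑B (suc m)))
miss-mono (false ∷ A) (false ∷ B) A⊑B = s≤s (miss-mono A B (λ m → A⊑B (suc m)))

miss-strict : ∀ {n} (A B : Subset n) t → A ⊑ B → mem B t ≡ true → mem A t ≡ false → suc (miss B) ≤ miss A
miss-strict (true ∷ A)  (b ∷ B)     zero    A⊑B tB ()
miss-strict (false ∷ A) (true ∷ B)  zero    A⊑B tB tA = s≤s (miss-mono A B (λ m → A⊑B (suc m)))
miss-strict (false ∷ A) (false ∷ B) zero    A⊑B () tA
miss-strict (true ∷ A)  (true ∷ B)  (suc t) A⊑B tB tA = miss-strict A B t (λ m → A⊑B (suc m)) tB tA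
miss-strict (true ∷ A)  (false ∷ B) (suc t) A⊑B tB tA with A⊑B 0 refl
... | ()
miss-strict (false ∷ A) (true ∷ B)  (suc t) A⊑B tB tA = m≤n⇒m≤1+n (miss-strict A B t (λ m → A⊑B (suc m)) tB tA)
miss-strict (false ∷ A) (false ∷ B) (suc t) A⊑B tB tA = s≤s (miss-strict A B t (λ m → A⊑B (suc m)) tB tA)

miss-∪-new : ∀ {n} (A B : Subset n) x → mem B x ≡ true → mem A x ≡ false → suc (miss (A ∪ B)) ≤ miss A
miss-∪-new A B x xB xA = miss-strict A (A ∪ B) x (⊑-∪ˡ A B) (⊑-∪ʳ A B x xB) xA

mem-∅ : ∀ {n} m → mem (∅ {n}) m ≡ false
mem-∅ {zero}  m       = refl
mem-∅ {suc n} zero    = refl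
mem-∅ {suc n} (suc m) = mem-∅ {n} m

miss-∅ : ∀ n → miss (∅ {n}) ≡ n
miss-∅ zero    = refl
miss-∅ (suc n) = cong suc (miss-∅ n)

sing : ∀ n → ℕ → Subset n
sing zero    a       = []
sing (suc n) zero    = true ∷ ∅
sing (suc n) (suc a) = false ∷ sing n a

mem-sing-self : ∀ n a → a < n → mem (sing n a) a ≡ true
mem-sing-self (suc n) zero    a<n       = refl
mem-sing-self (suc n) (suc a) (s≤s a<n) = mem-sing-self n a a<n

mem-sing : ∀ n a m → mem (sing n a) m ≡ true → m ≡ a
mem-sing (suc n) zero    zero    e = refl
mem-sing (suc n) zero    (suc m) e = ⊥-elim (true≢false e (mem-∅ {n} m))
mem-sing (suc n) (suc a) (suc m) e = cong suc (mem-sing n a m e)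

mem-sing-other : ∀ n a m → m ≢ a → mem (sing n a) m ≡ false
mem-sing-other n a m m≢a = ¬true⇒false (λ e → m≢a (mem-sing n a m e))

miss-∪-sing : ∀ {n} (A : Subset n) x → miss A ≤ suc (miss (A ∪ sing n x))
miss-∪-sing []          x       = z≤n
miss-∪-sing (true ∷ A)  zero    rewrite ∪-identityʳ A = n≤1+n _
miss-∪-sing (false ∷ A) zero    rewrite ∪-identityʳ A = ≤-refl
miss-∪-sing (true ∷ A)  (suc x) = miss-∪-sing A x
miss-∪-sing (false ∷ A) (suc x) = s≤s (miss-∪-sing A x)

miss-strict₂ : ∀ {n} (A C : Subset n) x y → A ⊑ C → mem C x ≡ true → mem C y ≡ true →
  mem A x ≡ false → mem A y ≡ false → x ≢ y → suc (suc (miss C)) ≤ miss A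
miss-strict₂ {n} A C x y A⊑C xC yC xA yA x≢y =
  ≤-trans (s≤s (miss-strict A′ C y A′⊑C yC yA′)) (miss-strict A A′ x (⊑-∪ˡ A _) x∈A′ xA)
  where
    A′ = A ∪ sing n x
    x∈A′ = ⊑-∪ʳ A (sing n x) x (mem-sing-self n x (mem⇒< C x xC))
    A′⊑C : A′ ⊑ C
    A′⊑C = ⊑-lub A (sing n x) {C} A⊑C (λ m e → subst (λ z → mem C z ≡ true) (sym (mem-sing n x m e)) xC)
    yA′ : mem A′ y ≡ false
    yA′ = ∪-outside A (sing n x) y yA (mem-sing-other n x y (λ e → x≢y (sym e)))

fromList : ∀ n → List ℕ → Subset n
fromList n []      = ∅
fromList n (a ∷ L) = sing n a ∪ fromList n L

mem-fromList : ∀ n L m → mem (fromList n L) m ≡ true → m ∈ₗ L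
mem-fromList n []      m e = ⊥-elim (true≢false e (mem-∅ {n} m))
mem-fromList n (a ∷ L) m e with ∪-split (sing n a) (fromList n L) m e
... | inj₁ e′ = here (mem-sing n a m e′)
... | inj₂ e′ = there (mem-fromList n L m e′)

fromList-mem : ∀ n L m → m ∈ₗ L → m < n → mem (fromList n L) m ≡ true
fromList-mem n (a ∷ L) m (here refl) m<n = ⊑-∪ˡ (sing n a) _ m (mem-sing-self n a m<n)
fromList-mem n (a ∷ L) m (there m∈L) m<n = ⊑-∪ʳ (sing n a) _ m (fromList-mem n L m m∈L m<n)

miss-∪-fromList : ∀ {n} (A : Subset n) L → miss A ≤ miss (A ∪ fromList n L) + length L
miss-∪-fromList {n} A [] rewrite ∪-identityʳ A | +-identityʳ (miss A) = ≤-refl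
miss-∪-fromList {n} A (a ∷ L) = begin
  miss A                                      ≤⟨ miss-∪-sing A a ⟩
  suc (miss A′)                               ≤⟨ s≤s (miss-∪-fromList A′ L) ⟩
  suc (miss (A′ ∪ fromList n L) + length L)   ≡⟨ cong (λ S → suc (miss S + length L)) (∪-assoc A (sing n a) _) ⟩
  suc (miss (A ∪ fromList n (a ∷ L)) + length L) ≡⟨ sym (+-suc _ (length L)) ⟩
  miss (A ∪ fromList n (a ∷ L)) + length (a ∷ L) ∎
  where
    open ≤-Reasoning
    A′ = A ∪ sing n a

miss-∪-fromList-new : ∀ {n} (A : Subset n) L → Unique L → All (_< n) L → (∀ m → m ∈ₗ L → mem A m ≡ false) →
  miss (A ∪ fromList n L) + length L ≤ miss A
miss-∪-fromList-new {n} A [] _ _ _ rewrite ∪-identityʳ A | +-identityʳ (miss A) = ≤-refl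
miss-∪-fromList-new {n} A (a ∷ L) (a∉L ∷ uniq) (a<n ∷ bounded) new = begin
  miss (A ∪ fromList n (a ∷ L)) + suc (length L) ≡⟨ cong (λ S → miss S + suc (length L)) (sym (∪-assoc A (sing n a) _)) ⟩
  miss (A′ ∪ fromList n L) + suc (length L)      ≡⟨ +-suc _ (length L) ⟩
  suc (miss (A′ ∪ fromList n L) + length L)      ≤⟨ s≤s (miss-∪-fromList-new A′ L uniq bounded new′) ⟩
  suc (miss A′)                                  ≤⟨ miss-∪-new A (sing n a) a (mem-sing-self n a a<n) (new a (here refl)) ⟩
  miss A ∎
  where
    open ≤-Reasoning
    A′ = A ∪ sing n a
    new′ : ∀ m → m ∈ₗ L → mem A′ m ≡ false
    new′ m m∈L = ∪-outside A (sing n a) m (new m (there m∈L))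
                   (mem-sing-other n a m (λ m≡a → lookup a∉L m∈L (sym m≡a)))

mem-⊤ : ∀ {n} m → m < n → mem (⊤ {n}) m ≡ true
mem-⊤ {suc n} zero    _         = refl
mem-⊤ {suc n} (suc m) (s≤s m<n) = mem-⊤ m m<n

miss-⊤ : ∀ n → miss (⊤ {n}) ≡ 0
miss-⊤ zero    = refl
miss-⊤ (suc n) = miss-⊤ n

miss-full : ∀ {n} (X : Subset n) → (∀ m → m < n → mem X m ≡ true) → miss X ≡ 0
miss-full {n} X full = n≤0⇒n≡0 (subst (miss X ≤_) (miss-⊤ n) (miss-mono ⊤ X (λ m e → full m (mem⇒< ⊤ m e))))

ascending⇒unique : ∀ {L} → Linked _<_ L → Unique L
ascending⇒unique chain = AllPairs.map <⇒≢ (Linked⇒AllPairs <-trans chain)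

members : ∀ {n} (A : Subset n) L → Unique L → (∀ m → m ∈ₗ L → mem A m ≡ true) → miss A + length L ≤ n
members {n} A L uniq inA = begin
  miss A + length L                   ≤⟨ +-monoˡ-≤ (length L) (miss-mono (fromList n L) A L⊑A) ⟩
  miss (fromList n L) + length L      ≡⟨ cong (λ S → miss S + length L) (sym (∪-identityˡ (fromList n L))) ⟩
  miss (∅ ∪ fromList n L) + length L  ≤⟨ miss-∪-fromList-new ∅ L uniq (tabulate (λ {m} m∈L → mem⇒< A m (inA m m∈L)))
                                           (λ m _ → mem-∅ {n} m) ⟩
  miss (∅ {n})                        ≡⟨ miss-∅ n ⟩
  n ∎
  where
    open ≤-Reasoning
    L⊑A : fromList n L ⊑ A
    L⊑A m e = inA m (mem-fromList n L m e)

nonmembers : ∀ {n} (A : Subset n) L → Unique L → All (_< n) L → (∀ m → m ∈ₗ L → mem A m ≡ false) → length L ≤ miss A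
nonmembers A L uniq bounded out = ≤-trans (m≤n+m (length L) _) (miss-∪-fromList-new A L uniq bounded out)

cover : ∀ {n} (A : Subset n) L → (∀ m → m < n → mem A m ≡ false → m ∈ₗ L) → miss A ≤ length L
cover {n} A L covered = subst (miss A ≤_) (cong (_+ length L) (miss-full (A ∪ fromList n L) full)) (miss-∪-fromList A L)
  where
    full : ∀ m → m < n → mem (A ∪ fromList n L) m ≡ true
    full m m<n with boolCases (mem A m)
    ... | inj₁ mA = ⊑-∪ˡ A _ m mA
    ... | inj₂ mA = ⊑-∪ʳ A _ m (fromList-mem n L m (covered m m<n mA) m<n)

inside-fromList : ∀ {n} (X : Subset n) L → X ⊑ fromList n L → n ≤ miss X + length L
inside-fromList {n} X L X⊑L = begin
  n                                   ≡⟨ sym (miss-∅ n) ⟩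
  miss (∅ {n})                        ≤⟨ miss-∪-fromList (∅ {n}) L ⟩
  miss (∅ ∪ fromList n L) + length L  ≡⟨ cong (λ S → miss S + length L) (∪-identityˡ (fromList n L)) ⟩
  miss (fromList n L) + length L      ≤⟨ +-monoˡ-≤ (length L) (miss-mono X (fromList n L) X⊑L) ⟩
  miss X + length L ∎
  where open ≤-Reasoning

memLeft : ∀ {n} → Subset n → ℕ → Bool
memLeft A zero    = false
memLeft A (suc i) = mem A i

Isolated : ∀ {n} → Subset n → ℕ → Set
Isolated A i = mem A i ≡ true × mem A (suc i) ≡ false × memLeft A i ≡ false

memLeft-false : ∀ {n} (X : Subset n) i → (∀ i′ → i ≡ suc i′ → mem X i′ ≡ false) → memLeft X i ≡ false
memLeft-false X zero    h = refl
memLeft-false X (suc i) h = h i refl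

Isolated-⊑ : ∀ {n} (A C : Subset n) i → A ⊑ C → mem A i ≡ true → Isolated C i → Isolated A i
Isolated-⊑ A C i A⊑C iA (_ , rC , lC) =
  iA , ¬true⇒false (λ r → true≢false (A⊑C (suc i) r) rC) , memLeft-false A i left
  where
    left : ∀ i′ → i ≡ suc i′ → mem A i′ ≡ false
    left i′ refl = ¬true⇒false (λ l → true≢false (A⊑C i′ l) lC)

Isolated-∪ : ∀ {n} (A B : Subset n) i → Isolated A i → mem B (suc i) ≡ false → memLeft B i ≡ false → Isolated (A ∪ B) i
Isolated-∪ A B i (iA , rA , lA) rB lB = ⊑-∪ˡ A B i iA , ∪-outside A B (suc i) rA rB , left i lA lB
  where
    left : ∀ i → memLeft A i ≡ false → memLeft B i ≡ false → memLeft (A ∪ B) i ≡ false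
    left zero    _  _  = refl
    left (suc i) lA lB = ∪-outside A B i lA lB

isolated⇒∉F : ∀ {n} (A : Subset n) i → Isolated A i → ¬ pathFamily n A
isolated⇒∉F {n} A i (iA , rA , lA) (_ , noIso)
  with noIso (fromℕ< (mem⇒< A i iA)) (mem⇒∈′ A i (mem⇒< A i iA) iA)
... | j , adjacent , j∈A = neighbour adjacent
  where
    i<n = mem⇒< A i iA
    toℕ-i = toℕ-fromℕ< i<n
    jA = ∈⇒mem j∈A
    neighbour : Adjacent (fromℕ< i<n) j → ⊥
    neighbour (inj₁ j+1≡i) = noLeft i lA (trans (+-comm 1 (toℕ j)) (trans j+1≡i toℕ-i))
      where
        noLeft : ∀ i → memLeft A i ≡ false → suc (toℕ j) ≡ i → ⊥
        noLeft (suc i) l refl = true≢false jA l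
    neighbour (inj₂ i+1≡j) = true≢false (subst (λ z → mem A z ≡ true) j≡1+i jA) rA
      where
        j≡1+i : toℕ j ≡ suc i
        j≡1+i = trans (sym i+1≡j) (trans (cong (_+ 1) toℕ-i) (+-comm i 1))

noIsolated⇒F : ∀ {n} (A : Subset n) → (∃ λ m → mem A m ≡ true) → (∀ i → ¬ Isolated A i) → pathFamily n A
noIsolated⇒F {n} A (m , mA) noIso = mem⇒nonempty A m mA , neighbour
  where
    neighbour : ∀ x → x ∈ A → ∃ λ j → Adjacent x j × j ∈ A
    neighbour x x∈A with mem A (suc (toℕ x)) in rA | memLeft A (toℕ x) in lA
    ... | true  | _     = fromℕ< r<n , inj₂ (trans (+-comm (toℕ x) 1) (sym (toℕ-fromℕ< r<n))) , mem⇒∈′ A _ r<n rA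
      where r<n = mem⇒< A _ rA
    ... | false | false = ⊥-elim (noIso (toℕ x) (∈⇒mem x∈A , rA , lA))
    ... | false | true  = leftNeighbour (toℕ x) refl lA
      where
        leftNeighbour : ∀ t → toℕ x ≡ t → memLeft A t ≡ true → ∃ λ j → Adjacent x j × j ∈ A
        leftNeighbour (suc t) x≡1+t l =
          fromℕ< t<n , inj₁ (trans (cong (_+ 1) (toℕ-fromℕ< t<n)) (trans (+-comm t 1) (sym x≡1+t))) , mem⇒∈′ A t t<n l
          where t<n = mem⇒< A t l

-- F is union-closed over [n] (for n ≥ 2, so that [n] itself has no isolated point)
F-⊤ : ∀ n → 2 ≤ n → pathFamily n ⊤
F-⊤ n 2≤n = noIsolated⇒F ⊤ (0 , mem-⊤ 0 (≤-trans (s≤s z≤n) 2≤n)) noIso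
  where
    noIso : ∀ i → ¬ Isolated ⊤ i
    noIso zero    (_ , r , _) = true≢false (mem-⊤ 1 2≤n) r
    noIso (suc i) (e , _ , l) = true≢false (mem-⊤ {n} i (<-trans (n<1+n i) (mem⇒< ⊤ (suc i) e))) l

F-∪ : ∀ {n} (B C : Subset n) → pathFamily n B → pathFamily n C → pathFamily n (B ∪ C)
F-∪ {n} B C (neB , hB) (neC , hC) = (proj₁ neB , ∈∪ˡ (proj₂ neB)) , neighbour
  where
    ∈∪ˡ : ∀ {x} → x ∈ B → x ∈ B ∪ C
    ∈∪ˡ {x} x∈B = mem⇒∈ (B ∪ C) x (⊑-∪ˡ B C _ (∈⇒mem x∈B))
    ∈∪ʳ : ∀ {x} → x ∈ C → x ∈ B ∪ C
    ∈∪ʳ {x} x∈C = mem⇒∈ (B ∪ C) x (⊑-∪ʳ B C _ (∈⇒mem x∈C))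
    neighbour : ∀ x → x ∈ B ∪ C → ∃ λ j → Adjacent x j × j ∈ B ∪ C
    neighbour x x∈BC with ∪-split B C (toℕ x) (∈⇒mem x∈BC)
    ... | inj₁ e = let (j , a , j∈B) = hB x (mem⇒∈ B x e) in j , a , ∈∪ˡ j∈B
    ... | inj₂ e = let (j , a , j∈C) = hC x (mem⇒∈ C x e) in j , a , ∈∪ʳ j∈C

F-unionClosed : ∀ n → 2 ≤ n → UnionClosed (pathFamily n)
F-unionClosed n 2≤n = F-⊤ n 2≤n , F-∪

pair : ∀ n → ℕ → Subset n
pair n x = fromList n (x ∷ suc x ∷ [])

mem-pair : ∀ n x m → mem (pair n x) m ≡ true → m ≡ x ⊎ m ≡ suc x
mem-pair n x m e with mem-fromList n (x ∷ suc x ∷ []) m e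
... | here m≡x          = inj₁ m≡x
... | there (here m≡1+x) = inj₂ m≡1+x

mem-pair-other : ∀ n x m → m ≢ x → m ≢ suc x → mem (pair n x) m ≡ false
mem-pair-other n x m m≢x m≢1+x = ¬true⇒false (λ e → [ m≢x , m≢1+x ]′ (mem-pair n x m e))

pair-left : ∀ n x → suc x < n → mem (pair n x) x ≡ true
pair-left n x 1+x<n = fromList-mem n (x ∷ suc x ∷ []) x (here refl) (<-trans (n<1+n x) 1+x<n)

pair-right : ∀ n x → suc x < n → mem (pair n x) (suc x) ≡ true
pair-right n x 1+x<n = fromList-mem n (x ∷ suc x ∷ []) (suc x) (there (here refl)) 1+x<n

pair-F : ∀ n x → suc x < n → pathFamily n (pair n x)
pair-F n x 1+x<n = noIsolated⇒F (pair n x) (x , pair-left n x 1+x<n) noIso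
  where
    noIso : ∀ i → ¬ Isolated (pair n x) i
    noIso i (iP , rP , lP) with mem-pair n x i iP
    ... | inj₁ refl = true≢false (pair-right n x 1+x<n) rP
    ... | inj₂ refl = true≢false (pair-left n x 1+x<n) lP

closure-intro : ∀ {n} (H : Family n) (A : Subset n) → UnionClosed H → Nonempty A →
  (∀ B x → H B → mem B x ≡ true → mem A x ≡ false → H (A ∪ B)) → closure H A
closure-intro H A (H⊤ , H∪) neA grow = neA , inj₁ H⊤ , closed
  where
    absorb : ∀ B → H B → (H ∪｛ A ｝) (A ∪ B)
    absorb B hB with ⊑-or-new A B
    ... | inj₁ B⊑A            = inj₂ (⊑⇒∪≡ A B B⊑A)
    ... | inj₂ (x , xB , xA) = inj₁ (grow B x hB xB xA)
    closed : ∀ B C → (H ∪｛ A ｝) B → (H ∪｛ A ｝) C → (H ∪｛ A ｝) (B ∪ C)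
    closed B C (inj₁ hB)   (inj₁ hC)   = inj₁ (H∪ B C hB hC)
    closed B C (inj₁ hB)   (inj₂ refl) = subst (H ∪｛ A ｝) (∪-comm A B) (absorb B hB)
    closed B C (inj₂ refl) (inj₁ hC)   = absorb C hC
    closed B C (inj₂ refl) (inj₂ refl) = inj₂ (∪-idem A)

closure-∪-new : ∀ {n} (H : Family n) (A B : Subset n) x → closure H A → H B →
  mem B x ≡ true → mem A x ≡ false → H (A ∪ B)
closure-∪-new H A B x (_ , _ , closed) hB xB xA with closed A B (inj₂ refl) (inj₁ hB)
... | inj₁ hAB  = hAB
... | inj₂ AB≡A = ⊥-elim (true≢false (subst (λ S → mem S x ≡ true) AB≡A (⊑-∪ʳ A B x xB)) xA)

NonemptyUnionClosed : ∀ {n} → Family n → Set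
NonemptyUnionClosed {n} H = UnionClosed H × (∀ X → H X → Nonempty X)

⊆-closure : ∀ {n} (H : Family n) → NonemptyUnionClosed H → ∀ A → H A → closure H A
⊆-closure H (uc , ne) A hA = closure-intro H A uc (ne A hA) (λ B _ hB _ _ → proj₂ uc A B hA hB)

-- and its closure is again union-closed: for A₁, A₂ in the closure and Y ∈ H
-- with a new point, A₂ absorbs Y and then A₁ absorbs A₂ ∪ Y
closure-nonemptyUnionClosed : ∀ {n} (H : Family n) → NonemptyUnionClosed H → NonemptyUnionClosed (closure H)
closure-nonemptyUnionClosed {n} H nuc@(uc , _) = (⊆-closure H nuc ⊤ (proj₁ uc) , closed) , λ X c → proj₁ c
  where
    closed : ∀ A₁ A₂ → closure H A₁ → closure H A₂ → closure H (A₁ ∪ A₂)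
    closed A₁ A₂ c₁ c₂ = closure-intro H (A₁ ∪ A₂) uc ne grow
      where
        ne : Nonempty (A₁ ∪ A₂)
        ne = proj₁ (proj₁ c₁) , mem⇒∈ (A₁ ∪ A₂) _ (⊑-∪ˡ A₁ A₂ _ (∈⇒mem (proj₂ (proj₁ c₁))))
        grow : ∀ Y x → H Y → mem Y x ≡ true → mem (A₁ ∪ A₂) x ≡ false → H ((A₁ ∪ A₂) ∪ Y)
        grow Y x hY xY xA with boolCases (mem A₁ x) | boolCases (mem A₂ x)
        ... | inj₁ x₁ | _       = ⊥-elim (true≢false (⊑-∪ˡ A₁ A₂ x x₁) xA)
        ... | inj₂ _  | inj₁ x₂ = ⊥-elim (true≢false (⊑-∪ʳ A₁ A₂ x x₂) xA)
        ... | inj₂ x₁ | inj₂ x₂ = subst H (sym (∪-assoc A₁ A₂ Y))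
              (closure-∪-new H A₁ (A₂ ∪ Y) x c₁ (closure-∪-new H A₂ Y x c₂ hY xY x₂) (⊑-∪ʳ A₂ Y x xY) x₁)

G : ∀ n → ℕ → Family n
G n k = closureIter k (pathFamily n)

G-nonemptyUnionClosed : ∀ n → 2 ≤ n → ∀ k → NonemptyUnionClosed (G n k)
G-nonemptyUnionClosed n 2≤n zero    = F-unionClosed n 2≤n , λ X f → proj₁ f
G-nonemptyUnionClosed n 2≤n (suc k) = closure-nonemptyUnionClosed (G n k) (G-nonemptyUnionClosed n 2≤n k)

G-nonempty : ∀ n → 2 ≤ n → ∀ k A → G n k A → Nonempty A
G-nonempty n 2≤n k = proj₂ (G-nonemptyUnionClosed n 2≤n k)

G-mono : ∀ n → 2 ≤ n → ∀ {k j} A → k ≤ j → G n k A → G n j A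
G-mono n 2≤n {k} A k≤j hA with m≤n⇒∃[o]m+o≡n k≤j
... | o , refl = climb o
  where
    climb : ∀ o → G n (k + o) A
    climb zero    rewrite +-identityʳ k = hA
    climb (suc o) rewrite +-suc k o = ⊆-closure (G n (k + o)) (G-nonemptyUnionClosed n 2≤n (k + o)) A (climb o)

F⊆G : ∀ n → 2 ≤ n → ∀ k A → pathFamily n A → G n k A
F⊆G n 2≤n k A f = G-mono n 2≤n {0} {k} A z≤n f

lowerStep : ∀ n → 2 ≤ n → ∀ k A → Nonempty A →
  (∀ B x → G n k B → mem B x ≡ true → mem A x ≡ false → G n k (A ∪ B)) → G n (suc k) A
lowerStep n 2≤n k A = closure-intro (G n k) A (proj₁ (G-nonemptyUnionClosed n 2≤n k))

upperStep : ∀ n k A B x → G n k B → mem B x ≡ true → mem A x ≡ false → ¬ G n k (A ∪ B) → ¬ G n (suc k) A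
upperStep n k A B x hB xB xA AB∉G A∈G = AB∉G (closure-∪-new (G n k) A B x A∈G hB xB xA)

miss≡0⇒⊤ : ∀ {n} (A : Subset n) → miss A ≡ 0 → A ≡ ⊤
miss≡0⇒⊤ []         _ = refl
miss≡0⇒⊤ (true ∷ A) e = cong (true ∷_) (miss≡0⇒⊤ A e)

fewMissing⇒G : ∀ n → 2 ≤ n → ∀ k A → Nonempty A → miss A ≤ k → G n k A
fewMissing⇒G n 2≤n zero    A _   m≤0 = subst (pathFamily n) (sym (miss≡0⇒⊤ A (n≤0⇒n≡0 m≤0))) (F-⊤ n 2≤n)
fewMissing⇒G n 2≤n (suc k) A neA m≤k = lowerStep n 2≤n k A neA grow
  where
    grow : ∀ B x → G n k B → mem B x ≡ true → mem A x ≡ false → G n k (A ∪ B)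
    grow B x _ xB xA = fewMissing⇒G n 2≤n k (A ∪ B) (mem⇒nonempty (A ∪ B) x (⊑-∪ʳ A B x xB))
                         (≤-pred (≤-trans (miss-∪-new A B x xB xA) m≤k))

anyMember : ∀ {n} → Subset n → Bool
anyMember []      = false
anyMember (b ∷ A) = b ∨ anyMember A

below : ∀ {n} → Subset n → ℕ → Bool
below []      _       = false
below (b ∷ A) zero    = false
below (b ∷ A) (suc i) = b ∨ below A i

above : ∀ {n} → Subset n → ℕ → Bool
above []      _       = false
above (b ∷ A) zero    = anyMember A
above (b ∷ A) (suc i) = above A i

anyMember-intro : ∀ {n} (A : Subset n) m → mem A m ≡ true → anyMember A ≡ true
anyMember-intro (true ∷ A) zero    e = refl
anyMember-intro (b ∷ A)    (suc m) e rewrite anyMember-intro A m e = ∨-zeroʳ b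

anyMember-elim : ∀ {n} (A : Subset n) → anyMember A ≡ true → ∃ λ m → mem A m ≡ true
anyMember-elim (true ∷ A)  e = 0 , refl
anyMember-elim (false ∷ A) e with anyMember-elim A e
... | m , mA = suc m , mA

below-intro : ∀ {n} (A : Subset n) a i → a < i → mem A a ≡ true → below A i ≡ true
below-intro (true ∷ A) zero    (suc i) a<i       e = refl
below-intro (b ∷ A)    (suc a) (suc i) (s≤s a<i) e rewrite below-intro A a i a<i e = ∨-zeroʳ b

below-elim : ∀ {n} (A : Subset n) i → below A i ≡ true → ∃ λ a → a < i × mem A a ≡ true
below-elim (true ∷ A)  (suc i) e = 0 , s≤s z≤n , refl
below-elim (false ∷ A) (suc i) e with below-elim A i e
... | a , a<i , aA = suc a , s≤s a<i , aA

above-intro : ∀ {n} (A : Subset n) i b → i < b → mem A b ≡ true → above A i ≡ true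
above-intro (c ∷ A) zero    (suc b) i<b       e = anyMember-intro A b e
above-intro (c ∷ A) (suc i) (suc b) (s≤s i<b) e = above-intro A i b i<b e

above-elim : ∀ {n} (A : Subset n) i → above A i ≡ true → ∃ λ b → i < b × mem A b ≡ true
above-elim (c ∷ A) zero    e with anyMember-elim A e
... | m , mA = suc m , s≤s z≤n , mA
above-elim (c ∷ A) (suc i) e with above-elim A i e
... | b , i<b , bA = suc b , s≤s i<b , bA

below-absent : ∀ {n} (A : Subset n) i a → below A i ≡ false → a < i → mem A a ≡ false
below-absent A i a none a<i = ¬true⇒false (λ aA → true≢false (below-intro A a i a<i aA) none)

above-absent : ∀ {n} (A : Subset n) i b → above A i ≡ false → i < b → mem A b ≡ false
above-absent A i b none i<b = ¬true⇒false (λ bA → true≢false (above-intro A i b i<b bA) none)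

below-mono : ∀ {n} (A B : Subset n) i → A ⊑ B → below A i ≡ true → below B i ≡ true
below-mono A B i A⊑B e with below-elim A i e
... | a , a<i , aA = below-intro B a i a<i (A⊑B a aA)

above-mono : ∀ {n} (A B : Subset n) i → A ⊑ B → above A i ≡ true → above B i ≡ true
above-mono A B i A⊑B e with above-elim A i e
... | b , i<b , bA = above-intro B i b i<b (A⊑B b bA)

no-sides⇒⊑sing : ∀ {n} (X : Subset n) i → below X i ≡ false → above X i ≡ false → X ⊑ sing n i
no-sides⇒⊑sing {n} X i bl ab m mX with <-cmp m i
... | tri< m<i _ _ = ⊥-elim (true≢false mX (below-absent X i m bl m<i))
... | tri≈ _ refl _ = mem-sing-self n m (mem⇒< X m mX)
... | tri> _ _ i<m = ⊥-elim (true≢false mX (above-absent X i m ab i<m))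

ind : Bool → ℕ
ind true  = 1
ind false = 0

ind≤1 : ∀ b → ind b ≤ 1
ind≤1 true  = ≤-refl
ind≤1 false = z≤n

sides : ∀ {n} → Subset n → ℕ → ℕ
sides A i = ind (below A i) + ind (above A i)

sides≤2 : ∀ {n} (A : Subset n) i → sides A i ≤ 2
sides≤2 A i = +-mono-≤ (ind≤1 (below A i)) (ind≤1 (above A i))

ind-mono : ∀ {a b} → (a ≡ true → b ≡ true) → ind a ≤ ind b
ind-mono {true}  {b} h rewrite h refl = ≤-refl
ind-mono {false}     h = z≤n

sides-mono : ∀ {n} (A B : Subset n) i → A ⊑ B → sides A i ≤ sides B i
sides-mono A B i A⊑B = +-mono-≤ (ind-mono (below-mono A B i A⊑B)) (ind-mono (above-mono A B i A⊑B))

-- The cost of i is its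
-- weight plus the number of missing positions; the characterisation of G k
-- says that A ∈ G k iff every isolated point costs at most k + 3.

isEnd : ℕ → ℕ → Bool
isEnd n i = (i ≡ᵇ 0) ∨ (suc i ≡ᵇ n)

isNearEnd : ℕ → ℕ → Bool
isNearEnd n i = (i ≡ᵇ 1) ∨ (suc (suc i) ≡ᵇ n)

weightRule : Bool → Bool → ℕ → ℕ
weightRule true  _     s = 3
weightRule false true  s = 2
weightRule false false s = s

weight : ∀ {n} → Subset n → ℕ → ℕ
weight {n} A i = weightRule (isEnd n i) (isNearEnd n i) (sides A i)

cost : ∀ {n} → Subset n → ℕ → ℕ
cost A i = weight A i + miss A

Interior : ℕ → ℕ → Set
Interior n i = 2 ≤ i × 3 + i ≤ n

interior? : ∀ n i → Dec (Interior n i)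
interior? n i = (2 ≤? i) ×-dec (3 + i ≤? n)

≡ᵇ-false : ∀ m n → m ≢ n → (m ≡ᵇ n) ≡ false
≡ᵇ-false m n m≢n = ¬true⇒false (λ e → m≢n (≡ᵇ⇒≡ m n (subst T (sym e) tt)))

≡ᵇ-true : ∀ n → (n ≡ᵇ n) ≡ true
≡ᵇ-true zero    = refl
≡ᵇ-true (suc n) = ≡ᵇ-true n

weight-interior : ∀ {n} i → Interior n i → ∀ (X : Subset n) → weight X i ≡ sides X i
weight-interior {n} i (2≤i , 3+i≤n) X
  rewrite ≡ᵇ-false i 0 (>⇒≢ (≤-trans (s≤s z≤n) 2≤i)) | ≡ᵇ-false (suc i) n (<⇒≢ (≤-trans (s≤s (s≤s (n≤1+n _))) 3+i≤n))
        | ≡ᵇ-false i 1 (>⇒≢ 2≤i) | ≡ᵇ-false (suc (suc i)) n (<⇒≢ 3+i≤n) = refl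

boundary-flags : ∀ n i → i < n → ¬ Interior n i → isEnd n i ≡ true ⊎ isNearEnd n i ≡ true
boundary-flags n zero          _   _       = inj₁ refl
boundary-flags n (suc zero)    _   _       = inj₂ refl
boundary-flags n i@(suc (suc _)) i<n notInt with m≤n⇒m<n∨m≡n i<n
... | inj₂ refl = inj₁ (trans (cong ((i ≡ᵇ 0) ∨_) (≡ᵇ-true n)) (∨-zeroʳ (i ≡ᵇ 0)))
... | inj₁ 2+i≤n with m≤n⇒m<n∨m≡n 2+i≤n
...   | inj₂ refl = inj₂ (trans (cong ((i ≡ᵇ 1) ∨_) (≡ᵇ-true n)) (∨-zeroʳ (i ≡ᵇ 1)))
...   | inj₁ 3+i≤n = ⊥-elim (notInt (s≤s (s≤s z≤n) , 3+i≤n))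

weight-boundary : ∀ {n} i → i < n → ¬ Interior n i → (∀ (X Y : Subset n) → weight X i ≡ weight Y i) × (∀ (X : Subset n) → 2 ≤ weight X i)
weight-boundary {n} i i<n notInt = fixed (isEnd n i) (isNearEnd n i) (boundary-flags n i i<n notInt)
  where
    fixed : ∀ e e′ → e ≡ true ⊎ e′ ≡ true →
      (∀ (X Y : Subset n) → weightRule e e′ (sides X i) ≡ weightRule e e′ (sides Y i)) × (∀ (X : Subset n) → 2 ≤ weightRule e e′ (sides X i))
    fixed true  _     _          = (λ _ _ → refl) , (λ _ → s≤s (s≤s z≤n))
    fixed false true  _          = (λ _ _ → refl) , (λ _ → ≤-refl)
    fixed false false (inj₁ ())
    fixed false false (inj₂ ())

weightRule≤3 : ∀ e e′ s → s ≤ 2 → weightRule e e′ s ≤ 3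
weightRule≤3 true  _     s _   = ≤-refl
weightRule≤3 false true  s _   = n≤1+n 2
weightRule≤3 false false s s≤2 = m≤n⇒m≤1+n s≤2

weight≤3 : ∀ {n} (X : Subset n) i → weight X i ≤ 3
weight≤3 {n} X i = weightRule≤3 (isEnd n i) (isNearEnd n i) (sides X i) (sides≤2 X i)

weight≤2 : ∀ {n} (X : Subset n) i → 0 < i → suc i < n → weight X i ≤ 2
weight≤2 {n} X i 0<i 1+i<n rewrite ≡ᵇ-false i 0 (>⇒≢ 0<i) | ≡ᵇ-false (suc i) n (<⇒≢ 1+i<n) = notEnd (isNearEnd n i)
  where
    notEnd : ∀ e′ → weightRule false e′ (sides X i) ≤ 2
    notEnd true  = ≤-refl
    notEnd false = sides≤2 X i

weightRule-mono : ∀ e e′ {s t} → s ≤ t → weightRule e e′ s ≤ weightRule e e′ t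
weightRule-mono true  _     _   = ≤-refl
weightRule-mono false true  _   = ≤-refl
weightRule-mono false false s≤t = s≤t

weight-mono : ∀ {n} (X Y : Subset n) i → X ⊑ Y → weight X i ≤ weight Y i
weight-mono {n} X Y i X⊑Y = weightRule-mono (isEnd n i) (isNearEnd n i) (sides-mono X Y i X⊑Y)

-- Passing from B to a superset C, a
-- side of j becomes occupied only through a new point, so the weight grows by
-- at most the number of new points and the cost of j never increases.

below-gain : ∀ {n} (B C : Subset n) j → B ⊑ C →
  ind (below C j) ≤ ind (below B j) ⊎ (below B j ≡ false × ∃ λ a → a < j × mem C a ≡ true × mem B a ≡ false)
below-gain B C j B⊑C with below C j in eC | below B j in eB
... | false | _     = inj₁ z≤n
... | true  | true  = inj₁ ≤-refl
... | true  | false with below-elim C j eC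
...   | a , a<j , aC = inj₂ (refl , a , a<j , aC , below-absent B j a eB a<j)

above-gain : ∀ {n} (B C : Subset n) j → B ⊑ C →
  ind (above C j) ≤ ind (above B j) ⊎ (above B j ≡ false × ∃ λ b → j < b × mem C b ≡ true × mem B b ≡ false)
above-gain B C j B⊑C with above C j in eC | above B j in eB
... | false | _     = inj₁ z≤n
... | true  | true  = inj₁ ≤-refl
... | true  | false with above-elim C j eC
...   | b , j<b , bC = inj₂ (refl , b , j<b , bC , above-absent B j b eB j<b)

-- g new points may raise the weight by g while lowering miss by g
trade : ∀ {s s′ m m′} g → s ≤ s′ + g → g + m ≤ m′ → s + m ≤ s′ + m′
trade {s} {s′} {m} {m′} g s≤ gm≤ = begin
  s + m          ≤⟨ +-monoˡ-≤ m s≤ ⟩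
  (s′ + g) + m   ≡⟨ +-assoc s′ g m ⟩
  s′ + (g + m)   ≤⟨ +-monoʳ-≤ s′ gm≤ ⟩
  s′ + m′ ∎
  where open ≤-Reasoning

gain-one : ∀ {l r l′ r′} → l ≤ 1 → r ≤ r′ → l + r ≤ (l′ + r′) + 1
gain-one {l} {r} {l′} {r′} l≤1 r≤r′ = begin
  l + r          ≤⟨ +-mono-≤ l≤1 r≤r′ ⟩
  1 + r′         ≡⟨ +-comm 1 r′ ⟩
  r′ + 1         ≤⟨ +-monoˡ-≤ 1 (m≤n+m r′ l′) ⟩
  (l′ + r′) + 1 ∎
  where open ≤-Reasoning

gain-oneʳ : ∀ {l r l′ r′} → l ≤ l′ → r ≤ 1 → l + r ≤ (l′ + r′) + 1
gain-oneʳ {l} {r} {l′} {r′} l≤l′ r≤1 = begin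
  l + r          ≤⟨ +-mono-≤ l≤l′ r≤1 ⟩
  l′ + 1         ≤⟨ +-monoˡ-≤ 1 (m≤m+n l′ r′) ⟩
  (l′ + r′) + 1 ∎
  where open ≤-Reasoning

cost-mono : ∀ {n} (B C : Subset n) j → B ⊑ C → mem B j ≡ true → cost C j ≤ cost B j
cost-mono {n} B C j B⊑C jB with interior? n j
... | no notInt = +-mono-≤ (≤-reflexive (proj₁ (weight-boundary j (mem⇒< B j jB) notInt) C B)) (miss-mono B C B⊑C)
... | yes int rewrite weight-interior j int C | weight-interior j int B = gain (below-gain B C j B⊑C) (above-gain B C j B⊑C)
  where
    gain : ind (below C j) ≤ ind (below B j) ⊎ (below B j ≡ false × ∃ λ a → a < j × mem C a ≡ true × mem B a ≡ false) →
           ind (above C j) ≤ ind (above B j) ⊎ (above B j ≡ false × ∃ λ b → j < b × mem C b ≡ true × mem B b ≡ false) →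
           sides C j + miss C ≤ sides B j + miss B
    gain (inj₁ l) (inj₁ r) =
      trade 0 (subst (sides C j ≤_) (sym (+-identityʳ _)) (+-mono-≤ l r)) (miss-mono B C B⊑C)
    gain (inj₂ (_ , a , _ , aC , aB)) (inj₁ r) =
      trade 1 (gain-one (ind≤1 (below C j)) r) (miss-strict B C a B⊑C aC aB)
    gain (inj₁ l) (inj₂ (_ , b , _ , bC , bB)) =
      trade 1 (gain-oneʳ l (ind≤1 (above C j))) (miss-strict B C b B⊑C bC bB)
    gain (inj₂ (_ , a , a<j , aC , aB)) (inj₂ (_ , b , j<b , bC , bB)) =
      trade 2 (≤-trans (sides≤2 C j) (m≤n+m 2 _)) (miss-strict₂ B C a b B⊑C aC bC aB bB (<⇒≢ (<-trans a<j j<b)))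

-- a point j of C together with witnesses of its occupied sides are distinct members
occupied-count : ∀ {n} (C : Subset n) j → mem C j ≡ true → suc (sides C j + miss C) ≤ n
occupied-count {n} C j jC with below C j in l | above C j in r
... | false | false = subst (_≤ n) (+-comm (miss C) 1) (members C (j ∷ []) ([] ∷ []) λ { _ (here refl) → jC })
... | true  | false with below-elim C j l
...   | a , a<j , aC = subst (_≤ n) (+-comm (miss C) 2)
                         (members C (a ∷ j ∷ []) (ascending⇒unique (a<j ∷ [-]))
                           λ { _ (here refl) → aC ; _ (there (here refl)) → jC })
occupied-count {n} C j jC | false | true with above-elim C j r
...   | b , j<b , bC = subst (_≤ n) (+-comm (miss C) 2)
                         (members C (j ∷ b ∷ []) (ascending⇒unique (j<b ∷ [-]))
                           λ { _ (here refl) → jC ; _ (there (here refl)) → bC })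
occupied-count {n} C j jC | true | true with below-elim C j l | above-elim C j r
...   | a , a<j , aC | b , j<b , bC = subst (_≤ n) (+-comm (miss C) 3)
         (members C (a ∷ j ∷ b ∷ []) (ascending⇒unique (a<j ∷ j<b ∷ [-]))
           λ { _ (here refl) → aC ; _ (there (here refl)) → jC ; _ (there (there (here refl))) → bC })

cost-via-other : ∀ {n} (B C : Subset n) j y → Interior n j → Isolated C j → B ⊑ C → mem B j ≡ false →
  Isolated B y → cost C j ≤ cost B y
cost-via-other {n} B C j y int isoC B⊑C jB isoB with 1 ≤? weight B y
... | yes 1≤w = begin
  weight C j + miss C         ≤⟨ +-monoˡ-≤ (miss C) (≤-trans (≤-reflexive (weight-interior j int C)) (sides≤2 C j)) ⟩
  1 + suc (miss C)        ≤⟨ +-mono-≤ 1≤w (miss-strict B C j B⊑C (proj₁ isoC) jB) ⟩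
  weight B y + miss B ∎
  where open ≤-Reasoning
... | no w<1 = begin
  weight C j + miss C         ≡⟨ cong (_+ miss C) (weight-interior j int C) ⟩
  sides C j + miss C      ≤⟨ ≤-pred (≤-trans (occupied-count C j (proj₁ isoC)) B-small) ⟩
  miss B                  ≤⟨ m≤n+m (miss B) (weight B y) ⟩
  weight B y + miss B ∎
  where
    open ≤-Reasoning
    y<n = mem⇒< B y (proj₁ isoB)
    y-interior : Interior n y
    y-interior with interior? n y
    ... | yes int′  = int′
    ... | no notInt = ⊥-elim (w<1 (≤-trans (s≤s z≤n) (proj₂ (weight-boundary y y<n notInt) B)))
    no-sides : sides B y ≡ 0
    no-sides = n≤0⇒n≡0 (≤-pred (≰⇒> (λ 1≤s → w<1 (subst (1 ≤_) (sym (weight-interior y y-interior B)) 1≤s))))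
    no-below : below B y ≡ false
    no-below with below B y | no-sides
    ... | false | _  = refl
    ... | true  | ()
    no-above : above B y ≡ false
    no-above with above B y | no-sides
    ... | false | _ = refl
    ... | true  | e = ⊥-elim (1+n≢0 (trans (+-comm 1 (ind (below B y))) e))
    B-small : n ≤ suc (miss B)
    B-small = subst (n ≤_) (+-comm (miss B) 1)
                (inside-fromList B (y ∷ []) (λ m e → ⊑-∪ˡ (sing n y) ∅ m (no-sides⇒⊑sing B y no-below no-above m e)))

isEnd-true : ∀ n i → isEnd n i ≡ true → i ≡ 0 ⊎ suc i ≡ n
isEnd-true n zero    _ = inj₁ refl
isEnd-true n (suc i) e = inj₂ (≡ᵇ⇒≡ (suc (suc i)) n (subst T (sym e) tt))

isEnd-false : ∀ n i → isEnd n i ≡ false → i ≢ 0 × suc i ≢ n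
isEnd-false n zero    ()
isEnd-false n (suc i) e = (λ ()) , λ eq → true≢false (trans (sym (cong (λ m → suc (suc i) ≡ᵇ m) eq)) (≡ᵇ-true (suc (suc i)))) e

weight-end : ∀ {n} (X : Subset n) i → isEnd n i ≡ true → weight X i ≡ 3
weight-end {n} X i e rewrite e = refl

weight-nearEnd : ∀ {n} (X : Subset n) i → isEnd n i ≡ false → isNearEnd n i ≡ true → weight X i ≡ 2
weight-nearEnd {n} X i e ne rewrite e | ne = refl

-- An interior isolated point i = p + 1 has the missing neighbours p and q = i + 1,
-- plus the missing position 0 (resp. n - 1) if its left (right) side is empty.
interior-cost≥4 : ∀ {e} (A : Subset (suc e)) i → Interior (suc e) i → Isolated A i → 4 ≤ sides A i + miss A
interior-cost≥4 {e} A i@(suc p) (s≤s 0<p , s≤s q<e) (iA , rA , lA) = bySides (below A i) (above A i) refl refl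
  where
    q = suc i
    p<q = <-trans (n<1+n p) (n<1+n i)
    q<n = m<n⇒m<1+n q<e
    p<n = <-trans p<q q<n
    first : below A i ≡ false → mem A 0 ≡ false
    first l = below-absent A i 0 l (s≤s z≤n)
    last : above A i ≡ false → mem A e ≡ false
    last r = above-absent A i e r (<-trans (n<1+n i) q<e)
    bySides : ∀ lb rb → below A i ≡ lb → above A i ≡ rb → 4 ≤ ind lb + ind rb + miss A
    bySides true true _ _ = s≤s (s≤s (nonmembers A (p ∷ q ∷ []) (ascending⇒unique (p<q ∷ [-]))
      (p<n ∷ q<n ∷ []) λ { _ (here refl) → lA ; _ (there (here refl)) → rA }))
    bySides true false _ r = s≤s (nonmembers A (p ∷ q ∷ e ∷ []) (ascending⇒unique (p<q ∷ q<e ∷ [-]))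
      (p<n ∷ q<n ∷ ≤-refl ∷ [])
      λ { _ (here refl) → lA ; _ (there (here refl)) → rA ; _ (there (there (here refl))) → last r })
    bySides false true l _ = s≤s (nonmembers A (0 ∷ p ∷ q ∷ []) (ascending⇒unique (0<p ∷ p<q ∷ [-]))
      (s≤s z≤n ∷ p<n ∷ q<n ∷ [])
      λ { _ (here refl) → first l ; _ (there (here refl)) → lA ; _ (there (there (here refl))) → rA })
    bySides false false l r = nonmembers A (0 ∷ p ∷ q ∷ e ∷ []) (ascending⇒unique (0<p ∷ p<q ∷ q<e ∷ [-]))
      (s≤s z≤n ∷ p<n ∷ q<n ∷ ≤-refl ∷ [])
      λ { _ (here refl) → first l ; _ (there (here refl)) → lA ; _ (there (there (here refl))) → rA
        ; _ (there (there (there (here refl)))) → last r }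

-- an isolated end of [n] has a neighbour, which is missing
end-miss≥1 : ∀ {n} (A : Subset n) i → 2 ≤ n → i ≡ 0 ⊎ suc i ≡ n → Isolated A i → 1 ≤ miss A
end-miss≥1 A zero 2≤n _ (_ , rA , _) = nonmembers A (1 ∷ []) ([] ∷ []) (2≤n ∷ []) λ { _ (here refl) → rA }
end-miss≥1 A (suc p) _ _ (iA , _ , lA) =
  nonmembers A (p ∷ []) ([] ∷ []) (<-trans (n<1+n p) (mem⇒< A (suc p) iA) ∷ []) λ { _ (here refl) → lA }

-- an isolated point away from the ends has two neighbours, both missing
inner-miss≥2 : ∀ {n} (A : Subset n) i → i ≢ 0 → suc i ≢ n → Isolated A i → 2 ≤ miss A
inner-miss≥2 A zero      i≢0 _ _ = ⊥-elim (i≢0 refl)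
inner-miss≥2 A i@(suc p) _ 1+i≢n (iA , rA , lA) =
  nonmembers A (p ∷ suc i ∷ []) (ascending⇒unique (<-trans (n<1+n p) (n<1+n i) ∷ [-]))
    (<-trans (n<1+n p) (mem⇒< A i iA) ∷ ≤∧≢⇒< (mem⇒< A i iA) 1+i≢n ∷ []) λ { _ (here refl) → lA ; _ (there (here refl)) → rA }

-- Every isolated point costs at least 4: the weight 3 at an end, 2 next to an
-- end, or the side count in the interior is made up by missing positions.
isolated-cost≥4 : ∀ {n} → 2 ≤ n → (A : Subset n) → ∀ i → Isolated A i → 4 ≤ cost A i
isolated-cost≥4 {suc e} 2≤n A i iso with interior? (suc e) i
... | yes int = subst (4 ≤_) (sym (cong (_+ miss A) (weight-interior i int A))) (interior-cost≥4 A i int iso)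
... | no notInt with boolCases (isEnd (suc e) i)
...   | inj₁ end = subst (4 ≤_) (sym (cong (_+ miss A) (weight-end A i end)))
                     (s≤s (s≤s (s≤s (end-miss≥1 A i 2≤n (isEnd-true _ i end) iso))))
...   | inj₂ notEnd = subst (4 ≤_) (sym (cong (_+ miss A) (weight-nearEnd A i notEnd nearEnd)))
                        (s≤s (s≤s (inner-miss≥2 A i (proj₁ inner) (proj₂ inner) iso)))
  where
    inner = isEnd-false (suc e) i notEnd
    nearEnd : isNearEnd (suc e) i ≡ true
    nearEnd = [ (λ end → ⊥-elim (true≢false end notEnd)) , (λ ne → ne) ]′
                (boundary-flags (suc e) i (mem⇒< A i (proj₁ iso)) notInt)

CostBound : ∀ {n} → Subset n → ℕ → Set
CostBound A k = ∀ i → Isolated A i → cost A i ≤ k + 3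

lone-below⇒isolated : ∀ {n} (C : Subset n) j y → Isolated C j → y < j → mem C y ≡ true →
  (∀ t → mem C t ≡ true → t < j → t ≡ y) → Isolated C y
lone-below⇒isolated C j y (_ , _ , lj) y<j yC lone = yC , right , memLeft-false C y left
  where
    right : mem C (suc y) ≡ false
    right with m≤n⇒m<n∨m≡n y<j
    ... | inj₁ 1+y<j = ¬true⇒false (λ e → 1+n≢n (lone (suc y) e 1+y<j))
    ... | inj₂ refl  = ⊥-elim (true≢false yC lj)
    left : ∀ y′ → y ≡ suc y′ → mem C y′ ≡ false
    left y′ refl = ¬true⇒false (λ e → 1+n≢n (sym (lone y′ e (<-trans (n<1+n y′) y<j))))

lone-above⇒isolated : ∀ {n} (C : Subset n) j y → Isolated C j → j < y → mem C y ≡ true →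
  (∀ t → mem C t ≡ true → j < t → t ≡ y) → Isolated C y
lone-above⇒isolated C j y (_ , rj , _) j<y yC lone = yC , right , memLeft-false C y left
  where
    right : mem C (suc y) ≡ false
    right = ¬true⇒false (λ e → 1+n≢n (lone (suc y) e (<-trans j<y (n<1+n y))))
    left : ∀ y′ → y ≡ suc y′ → mem C y′ ≡ false
    left y′ refl with m≤n⇒m<n∨m≡n (≤-pred j<y)
    ... | inj₁ j<y′ = ¬true⇒false (λ e → 1+n≢n (sym (lone y′ e j<y′)))
    ... | inj₂ refl = ⊥-elim (true≢false yC rj)

-- four distinct points in C while A ⊑ {j} and j costs at most K + 1 in A
four-points-bound : ∀ {s m m′ K n} → s ≤ 2 → m + 4 ≤ n → n ≤ m′ + 1 → m′ ≤ suc K → s + m ≤ K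
four-points-bound {s} {m} {m′} {K} {n} s≤2 m+4≤n n≤m′+1 m′≤1+K =
  ≤-trans (+-monoˡ-≤ m s≤2) (+-cancelʳ-≤ 2 (2 + m) K (begin
    (2 + m) + 2   ≡⟨ shuffle m ⟩
    m + 4         ≤⟨ ≤-trans m+4≤n (≤-trans n≤m′+1 (+-monoˡ-≤ 1 m′≤1+K)) ⟩
    suc K + 1     ≡⟨ +-comm (suc K) 1 ⟩
    suc (suc K)   ≡⟨ +-comm 2 K ⟩
    K + 2 ∎))
  where
    open ≤-Reasoning
    shuffle : ∀ m → (2 + m) + 2 ≡ m + 4
    shuffle = solve-∀

-- Two ways to bound the cost of an interior isolated point j of C = A ∪ B
-- lying in A but not in B.
cost-through-A : ∀ {n} k (A C : Subset n) j → Interior n j → cost A j ≤ suc k + 3 →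
  ∀ g → sides C j ≤ sides A j + g → g + suc (miss C) ≤ miss A → cost C j ≤ k + 3
cost-through-A k A C j int boundAj g s≤ m≤ = ≤-pred (begin
  suc (weight C j + miss C)       ≡⟨ cong (λ c → suc (c + miss C)) (weight-interior j int C) ⟩
  suc (sides C j + miss C)    ≡⟨ sym (+-suc (sides C j) (miss C)) ⟩
  sides C j + suc (miss C)    ≤⟨ trade g s≤ m≤ ⟩
  sides A j + miss A          ≡⟨ cong (_+ miss A) (sym (weight-interior j int A)) ⟩
  cost A j                    ≤⟨ boundAj ⟩
  suc k + 3 ∎)
  where open ≤-Reasoning

-- Second, through B: a point y ∉ A isolated in C belongs to B, is isolated
-- there, and pays for j by cost-via-other.
cost-through-B : ∀ {n} k (A B : Subset n) j y → Interior n j → CostBound B k → Isolated (A ∪ B) j →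
  mem B j ≡ false → mem (A ∪ B) y ≡ true → mem A y ≡ false → Isolated (A ∪ B) y → cost (A ∪ B) j ≤ k + 3
cost-through-B k A B j y int boundB isoC jB yC yA isoY =
  ≤-trans (cost-via-other B (A ∪ B) j y int isoC (⊑-∪ʳ A B) jB isoB) (boundB y isoB)
  where
    yB = [ (λ e → ⊥-elim (true≢false e yA)) , (λ e → e) ]′ (∪-split A B y yC)
    isoB = Isolated-⊑ B (A ∪ B) y (⊑-∪ʳ A B) yB isoY

-- Exactly one side of j became occupied, through a new point y.  Another new
-- point pays for the extra weight; otherwise y is the only new point, alone on
-- its side of j and hence isolated.
one-side-gained : ∀ {n} k (A B : Subset n) j y → Interior n j → cost A j ≤ suc k + 3 → CostBound B k →
  Isolated (A ∪ B) j → mem B j ≡ false → mem (A ∪ B) y ≡ true → mem A y ≡ false → sides (A ∪ B) j ≤ sides A j + 1 →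
  ((∀ t → mem (A ∪ B) t ≡ true → mem A t ≡ false → t ≡ y) → Isolated (A ∪ B) y) → cost (A ∪ B) j ≤ k + 3
one-side-gained k A B j y int boundAj boundB isoC jB yC yA s≤ loneIso
  with member? (A ∪ B) (λ t → mem A t ≡ false × t ≢ y) (λ t → (mem A t Bool.≟ false) ×-dec ¬? (t ≟ y))
... | inj₁ (t , tC , tA , t≢y) = cost-through-A k A (A ∪ B) j int boundAj 1 s≤ (miss-strict₂ A (A ∪ B) y t (⊑-∪ˡ A B) yC tC yA tA (≢-sym t≢y))
... | inj₂ none = cost-through-B k A B j y int boundB isoC jB yC yA (loneIso only)
  where
    only : ∀ t → mem (A ∪ B) t ≡ true → mem A t ≡ false → t ≡ y
    only t tC tA with t ≟ y
    ... | yes t≡y = t≡y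
    ... | no t≢y  = ⊥-elim (none t tC (tA , t≢y))

-- Both sides of j became occupied, through new points a < j < b; then A ⊑ {j}.
-- A fourth point of C makes miss C small enough; otherwise C = {a, j, b} and
-- a is isolated.
both-sides-gained : ∀ {n} k (A B : Subset n) j a b → Interior n j → cost A j ≤ suc k + 3 → CostBound B k →
  Isolated (A ∪ B) j → mem B j ≡ false → below A j ≡ false → above A j ≡ false →
  a < j → mem (A ∪ B) a ≡ true → mem A a ≡ false → j < b → mem (A ∪ B) b ≡ true → cost (A ∪ B) j ≤ k + 3
both-sides-gained {n} k A B j a b int boundAj boundB isoC jB noneBelow noneAbove a<j aC aA j<b bC
  with member? (A ∪ B) (λ t → t ≢ a × t ≢ j × t ≢ b) (λ t → ¬? (t ≟ a) ×-dec ¬? (t ≟ j) ×-dec ¬? (t ≟ b))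
... | inj₁ (t , tC , t≢a , t≢j , t≢b) =
  subst (_≤ k + 3) (sym (cong (_+ miss C) (weight-interior j int C)))
    (four-points-bound (sides≤2 C j)
      (members C (t ∷ a ∷ j ∷ b ∷ []) ((t≢a ∷ t≢j ∷ t≢b ∷ []) ∷ ascending⇒unique (a<j ∷ j<b ∷ [-]))
        λ { _ (here refl) → tC ; _ (there (here refl)) → aC ; _ (there (there (here refl))) → proj₁ isoC
          ; _ (there (there (there (here refl)))) → bC })
      (inside-fromList A (j ∷ []) (λ m e → ⊑-∪ˡ (sing n j) ∅ m (no-sides⇒⊑sing A j noneBelow noneAbove m e)))
      (≤-trans (m≤n+m (miss A) (weight A j)) boundAj))
  where C = A ∪ B
... | inj₂ none = cost-through-B k A B j a int boundB isoC jB aC aA (lone-below⇒isolated (A ∪ B) j a isoC a<j aC onlyA)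
  where
    onlyA : ∀ t → mem (A ∪ B) t ≡ true → t < j → t ≡ a
    onlyA t tC t<j with t ≟ a
    ... | yes t≡a = t≡a
    ... | no t≢a  = ⊥-elim (none t tC (t≢a , <⇒≢ t<j , <⇒≢ (<-trans t<j j<b)))

-- Every point of C
-- outside A lowers the cost of j by one, but a point occupying a new side also
-- raises the weight by one; the cases are sorted by the sides of j gained.
old-point-cost : ∀ {n} k (A B : Subset n) x j → mem B x ≡ true → mem A x ≡ false →
  CostBound A (suc k) → CostBound B k → Isolated (A ∪ B) j → mem A j ≡ true → mem B j ≡ false →
  cost (A ∪ B) j ≤ k + 3
old-point-cost {n} k A B x j xB xA boundA boundB isoC jA jB = byPosition (interior? n j)
  where
    C = A ∪ B
    A⊑C = ⊑-∪ˡ A B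
    boundAj : cost A j ≤ suc k + 3
    boundAj = boundA j (Isolated-⊑ A C j A⊑C jA isoC)
    bySides : Interior n j →
      ind (below C j) ≤ ind (below A j) ⊎ (below A j ≡ false × ∃ λ a → a < j × mem C a ≡ true × mem A a ≡ false) →
      ind (above C j) ≤ ind (above A j) ⊎ (above A j ≡ false × ∃ λ b → j < b × mem C b ≡ true × mem A b ≡ false) →
      cost C j ≤ k + 3
    bySides int (inj₁ l) (inj₁ r) = cost-through-A k A C j int boundAj 0
      (subst (sides C j ≤_) (sym (+-identityʳ _)) (+-mono-≤ l r)) (miss-∪-new A B x xB xA)
    bySides int (inj₂ (noneA , a , a<j , aC , aA)) (inj₁ r) =
      one-side-gained k A B j a int boundAj boundB isoC jB aC aA (gain-one (ind≤1 (below C j)) r)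
        (λ only → lone-below⇒isolated C j a isoC a<j aC (λ t tC t<j → only t tC (below-absent A j t noneA t<j)))
    bySides int (inj₁ l) (inj₂ (noneA , b , j<b , bC , bA)) =
      one-side-gained k A B j b int boundAj boundB isoC jB bC bA (gain-oneʳ l (ind≤1 (above C j)))
        (λ only → lone-above⇒isolated C j b isoC j<b bC (λ t tC j<t → only t tC (above-absent A j t noneA j<t)))
    bySides int (inj₂ (noneBelow , a , a<j , aC , aA)) (inj₂ (noneAbove , b , j<b , bC , _)) =
      both-sides-gained k A B j a b int boundAj boundB isoC jB noneBelow noneAbove a<j aC aA j<b bC
    -- away from the interior the weight is fixed and the new point x lowers the cost
    byPosition : Dec (Interior n j) → cost C j ≤ k + 3
    byPosition (no notInt) = ≤-pred (≤-trans (subst (_≤ cost A j) (+-suc (weight C j) (miss C))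
      (+-mono-≤ (≤-reflexive (proj₁ (weight-boundary j (mem⇒< A j jA) notInt) C A)) (miss-∪-new A B x xB xA))) boundAj)
    byPosition (yes int) = bySides int (below-gain A C j A⊑C) (above-gain A C j A⊑C)

-- The cost bound survives the union of a set bounded at level k + 1 with a set
-- bounded at level k bringing a new point: an isolated point of the union lying
-- in B costs no more than in B, one lying only in A is handled above.
costBound-∪ : ∀ {n} k (A B : Subset n) x → mem B x ≡ true → mem A x ≡ false →
  CostBound A (suc k) → CostBound B k → CostBound (A ∪ B) k
costBound-∪ k A B x xB xA boundA boundB j isoC with boolCases (mem B j)
... | inj₁ jB = ≤-trans (cost-mono B (A ∪ B) j (⊑-∪ʳ A B) jB) (boundB j (Isolated-⊑ B (A ∪ B) j (⊑-∪ʳ A B) jB isoC))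
... | inj₂ jB with ∪-split A B j (proj₁ isoC)
...   | inj₁ jA  = old-point-cost k A B x j xB xA boundA boundB isoC jA jB
...   | inj₂ jB′ = ⊥-elim (true≢false jB′ jB)

-- A growth point of A (relative to an isolated point i) is a
-- missing position x next to a member of A but not next to i: the pair formed
-- by x and that member lies in the path family and adds x while keeping i isolated.

GrowthPoint : ∀ {n} → Subset n → ℕ → ℕ → Set
GrowthPoint A i x = mem A x ≡ false × suc x ≢ i × x ≢ suc i × (mem A (suc x) ≡ true ⊎ memLeft A x ≡ true)

growthPoint? : ∀ {n} (A : Subset n) i x → Dec (GrowthPoint A i x)
growthPoint? A i x = (mem A x Bool.≟ false) ×-dec ¬? (suc x ≟ i) ×-dec ¬? (x ≟ suc i)
                       ×-dec ((mem A (suc x) Bool.≟ true) ⊎-dec (memLeft A x Bool.≟ true))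

NoGrowth : ∀ {n} → Subset n → ℕ → Set
NoGrowth {n} A i = ∀ x → x < n → ¬ GrowthPoint A i x

switch : (f : ℕ → Bool) (p d : ℕ) → f p ≢ f (p + d) → ∃ λ y → p ≤ y × suc y ≤ p + d × f y ≢ f (suc y)
switch f p zero    differ = ⊥-elim (differ (cong f (sym (+-identityʳ p))))
switch f p (suc d) differ with f p Bool.≟ f (suc p)
... | no  step = p , ≤-refl , subst (suc p ≤_) (sym (+-suc p d)) (s≤s (m≤m+n p d)) , step
... | yes same with switch f (suc p) d (λ e → differ (trans same (trans e (cong f (sym (+-suc p d))))))
...   | y , 1+p≤y , y<end , step = y , ≤-trans (n≤1+n p) 1+p≤y , subst (suc y ≤_) (sym (+-suc p d)) y<end , step

-- Without growth points, A is constant on each stretch of positions at distance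
-- at least 2 from i, since a change of membership would produce a growth point.
noGrowth-constant : ∀ {n} (A : Subset n) i → NoGrowth A i → ∀ p q → p ≤ q → q < n →
  suc (suc q) ≤ i ⊎ suc (suc i) ≤ p → mem A p ≡ mem A q
noGrowth-constant {n} A i none p q p≤q q<n far with mem A p Bool.≟ mem A q | m≤n⇒∃[o]m+o≡n p≤q
... | yes same  | _ = same
... | no differ | d , refl with switch (mem A) p d differ
...   | y , p≤y , y<q , step = ⊥-elim (change (mem A y) (mem A (suc y)) refl refl step)
  where
    yFar : suc (suc (suc y)) ≤ i ⊎ suc (suc i) ≤ y
    yFar = [ (λ left → inj₁ (≤-trans (s≤s (s≤s y<q)) left)) , (λ right → inj₂ (≤-trans right p≤y)) ]′ far
    1+y≢i : suc y ≢ i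
    1+y≢i = [ (λ left → <⇒≢ (≤-trans (n≤1+n _) left)) , (λ right → >⇒≢ (≤-trans (n≤1+n _) (≤-trans right (n≤1+n y)))) ]′ yFar
    y≢1+i : y ≢ suc i
    y≢1+i = [ (λ left → <⇒≢ (≤-trans (n≤1+n _) (≤-trans (n≤1+n _) (≤-trans left (n≤1+n i))))) , (λ right → >⇒≢ right) ]′ yFar
    y≢i : y ≢ i
    y≢i = [ (λ left → <⇒≢ (≤-trans (n≤1+n _) (≤-trans (n≤1+n _) left))) , (λ right → >⇒≢ (≤-trans (n≤1+n _) right)) ]′ yFar
    2+y≢i : suc (suc y) ≢ i
    2+y≢i = [ (λ left → <⇒≢ left) , (λ right → >⇒≢ (≤-trans (n≤1+n _) (≤-trans right (≤-trans (n≤1+n y) (n≤1+n _))))) ]′ yFar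
    change : ∀ b b′ → mem A y ≡ b → mem A (suc y) ≡ b′ → b ≢ b′ → ⊥
    change false false _  _  step = step refl
    change true  true  _  _  step = step refl
    change false true  ey ey′ _ = none y (<-trans (n<1+n y) (≤-<-trans y<q q<n)) (ey , 1+y≢i , y≢1+i , inj₁ ey′)
    change true  false ey ey′ _ = none (suc y) (≤-<-trans y<q q<n) (ey′ , 2+y≢i , y≢i ∘ suc-injective , inj₂ ey)

left-gap : ∀ {n} (A : Subset n) i a → Isolated A i → a < i → mem A a ≡ true → suc (suc a) ≤ i
left-gap A (suc i′) a (_ , _ , lA) a<i aA = ≤∧≢⇒< a<i (λ { refl → true≢false aA lA })

right-gap : ∀ {n} (A : Subset n) i b → Isolated A i → i < b → mem A b ≡ true → suc (suc i) ≤ b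
right-gap A i b (_ , rA , _) i<b bA = ≤∧≢⇒< i<b (λ { refl → true≢false bA rA })

noGrowth-missing : ∀ {n} (A : Subset n) i → NoGrowth A i → Isolated A i → ∀ m → m < n → mem A m ≡ false →
  suc m ≡ i ⊎ m ≡ suc i ⊎ (m < i × below A i ≡ false) ⊎ (i < m × above A i ≡ false)
noGrowth-missing A i none iso m m<n mA with <-cmp m i
... | tri≈ _ refl _ = ⊥-elim (true≢false (proj₁ iso) mA)
... | tri< m<i _ _ with suc m ≟ i
...   | yes 1+m≡i = inj₁ 1+m≡i
...   | no 1+m≢i with below A i in bl
...     | false = inj₂ (inj₂ (inj₁ (m<i , refl)))
...     | true with below-elim A i bl
...       | a , a<i , aA = ⊥-elim (true≢false (trans (sym (constant (≤-total m a))) aA) mA)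
  where
    constant : m ≤ a ⊎ a ≤ m → mem A a ≡ mem A m
    constant (inj₁ m≤a) = sym (noGrowth-constant A i none m a m≤a (mem⇒< A a aA) (inj₁ (left-gap A i a iso a<i aA)))
    constant (inj₂ a≤m) = noGrowth-constant A i none a m a≤m m<n (inj₁ (≤∧≢⇒< m<i 1+m≢i))
noGrowth-missing A i none iso m m<n mA | tri> _ _ i<m with m ≟ suc i
...   | yes m≡1+i = inj₂ (inj₁ m≡1+i)
...   | no m≢1+i with above A i in ab
...     | false = inj₂ (inj₂ (inj₂ (i<m , refl)))
...     | true with above-elim A i ab
...       | b , i<b , bA = ⊥-elim (true≢false (trans (sym (constant (≤-total m b))) bA) mA)
  where
    2+i≤m = ≤∧≢⇒< i<m (≢-sym m≢1+i)
    constant : m ≤ b ⊎ b ≤ m → mem A b ≡ mem A m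
    constant (inj₁ m≤b) = sym (noGrowth-constant A i none m b m≤b (mem⇒< A b bA) (inj₂ 2+i≤m))
    constant (inj₂ b≤m) = noGrowth-constant A i none b m b≤m m<n (inj₂ (right-gap A i b iso i<b bA))

-- Escapes.  A certificate that A ∉ G (k+1) via the upper step: a pair of the
-- path family bringing a point x new to A, such that i stays isolated in the
-- union and costs more than k + 3 there.
record Escape {n} (A : Subset n) (i k : ℕ) : Set where
  constructor escape
  field
    x₀        : ℕ
    x         : ℕ
    fits      : suc x₀ < n
    x∈pair    : mem (pair n x₀) x ≡ true
    x∉A       : mem A x ≡ false
    isolated  : Isolated (A ∪ pair n x₀) i
    expensive : k + 3 < cost (A ∪ pair n x₀) i

FarPair : ℕ → ℕ → Set
FarPair i x₀ = suc (suc (suc x₀)) ≤ i ⊎ suc (suc i) ≤ x₀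

farPair-isolated : ∀ {n} (A : Subset n) i x₀ → Isolated A i → FarPair i x₀ → Isolated (A ∪ pair n x₀) i
farPair-isolated {n} A i x₀ iso far =
  Isolated-∪ A (pair n x₀) i iso (mem-pair-other n x₀ (suc i) (≢-sym (x₀≢ far)) (≢-sym (1+x₀≢ far)))
    (memLeft-false (pair n x₀) i left)
  where
    x₀≢ : FarPair i x₀ → x₀ ≢ suc i
    x₀≢ (inj₁ l) = <⇒≢ (≤-trans (n≤1+n _) (≤-trans (n≤1+n _) (≤-trans l (n≤1+n i))))
    x₀≢ (inj₂ r) = >⇒≢ r
    1+x₀≢ : FarPair i x₀ → suc x₀ ≢ suc i
    1+x₀≢ (inj₁ l) = <⇒≢ (s≤s (≤-trans (n≤1+n _) (≤-trans (n≤1+n _) l)))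
    1+x₀≢ (inj₂ r) = >⇒≢ (≤-trans r (n≤1+n x₀))
    left : ∀ i′ → i ≡ suc i′ → mem (pair n x₀) i′ ≡ false
    left i′ refl = mem-pair-other n x₀ i′ (≢-sym (away far)) (≢-sym (away′ far))
      where
        away : FarPair (suc i′) x₀ → x₀ ≢ i′
        away (inj₁ l) = <⇒≢ (≤-trans (n≤1+n _) (≤-pred l))
        away (inj₂ r) = >⇒≢ (≤-trans (≤-trans (n≤1+n (suc i′)) (n≤1+n (suc (suc i′)))) r)
        away′ : FarPair (suc i′) x₀ → suc x₀ ≢ i′
        away′ (inj₁ l) = <⇒≢ (≤-pred l)
        away′ (inj₂ r) = >⇒≢ (≤-trans (≤-trans (n≤1+n (suc i′)) (n≤1+n (suc (suc i′)))) (≤-trans r (n≤1+n x₀)))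

pairEscape : ∀ {n} k (A : Subset n) i x₀ x → suc x₀ < n → Isolated A i → FarPair i x₀ →
  mem (pair n x₀) x ≡ true → mem A x ≡ false → suc k + 3 < cost A i → cost A i ≤ suc (cost (A ∪ pair n x₀) i) →
  Escape A i k
pairEscape k A i x₀ x fits iso far xP xA big lose =
  escape x₀ x fits xP xA (farPair-isolated A i x₀ iso far) (≤-pred (≤-trans big lose))

addOne-cost : ∀ {n} (A B : Subset n) x i → B ⊑ A ∪ sing n x → cost A i ≤ suc (cost (A ∪ B) i)
addOne-cost {n} A B x i B⊑ = begin
  weight A i + miss A                 ≤⟨ +-mono-≤ (weight-mono A (A ∪ B) i (⊑-∪ˡ A B)) (miss-∪-sing A x) ⟩
  weight (A ∪ B) i + suc (miss A′)    ≤⟨ +-monoʳ-≤ (weight (A ∪ B) i) (s≤s (miss-mono (A ∪ B) A′ (⊑-lub A B {A′} (⊑-∪ˡ A (sing n x)) B⊑))) ⟩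
  weight (A ∪ B) i + suc (miss (A ∪ B)) ≡⟨ +-suc (weight (A ∪ B) i) (miss (A ∪ B)) ⟩
  suc (cost (A ∪ B) i) ∎
  where
    open ≤-Reasoning
    A′ = A ∪ sing n x

-- A growth point x yields an escape: the pair of x and its neighbour in A adds
-- only x, keeps i isolated, and lowers the cost of i by at most one.
growth-escape : ∀ {n} k (A : Subset n) i x → x < n → Isolated A i → GrowthPoint A i x → suc k + 3 < cost A i → Escape A i k
growth-escape {n} k A i x _ iso (xA , 1+x≢i , x≢1+i , inj₁ rightA) big =
  pairEscape k A i x x fits iso far (pair-left n x fits) xA big (addOne-cost A (pair n x) x i inside)
  where
    fits = mem⇒< A (suc x) rightA
    far : FarPair i x
    far with <-cmp x i
    ... | tri< x<i _ _ = inj₁ (left-gap A i (suc x) iso (≤∧≢⇒< x<i 1+x≢i) rightA)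
    ... | tri≈ _ refl _ = ⊥-elim (true≢false (proj₁ iso) xA)
    ... | tri> _ _ i<x = inj₂ (≤∧≢⇒< i<x (≢-sym x≢1+i))
    inside : pair n x ⊑ A ∪ sing n x
    inside m e with mem-pair n x m e
    ... | inj₁ refl = ⊑-∪ʳ A (sing n x) x (mem-sing-self n x (<-trans (n<1+n x) fits))
    ... | inj₂ refl = ⊑-∪ˡ A (sing n x) (suc x) rightA
growth-escape {n} k A i (suc x′) fits iso (xA , 2+x′≢i , 1+x′≢1+i , inj₂ leftA) big =
  pairEscape k A i x′ (suc x′) fits iso far (pair-right n x′ fits) xA big (addOne-cost A (pair n x′) (suc x′) i inside)
  where
    far : FarPair i x′
    far with <-cmp x′ i
    ... | tri< x′<i _ _ = inj₁ (≤∧≢⇒< (left-gap A i x′ iso x′<i leftA) 2+x′≢i)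
    ... | tri≈ _ refl _ = ⊥-elim (1+x′≢1+i refl)
    ... | tri> _ _ i<x′ = inj₂ (right-gap A i x′ iso i<x′ leftA)
    inside : pair n x′ ⊑ A ∪ sing n (suc x′)
    inside m e with mem-pair n x′ m e
    ... | inj₁ refl = ⊑-∪ˡ A (sing n (suc x′)) x′ leftA
    ... | inj₂ refl = ⊑-∪ʳ A (sing n (suc x′)) (suc x′) (mem-sing-self n (suc x′) fits)

FreeSide : ∀ {n} → Subset n → ℕ → ℕ → Set
FreeSide A i x₀ = (suc (suc i) ≤ x₀ × above A i ≡ false) ⊎ (suc (suc (suc x₀)) ≤ i × below A i ≡ false)

freeSide-new : ∀ {n} (A : Subset n) i x₀ → FreeSide A i x₀ → mem A x₀ ≡ false
freeSide-new A i x₀ (inj₁ (2+i≤x₀ , ab)) = above-absent A i x₀ ab (≤-trans (n≤1+n _) 2+i≤x₀)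
freeSide-new A i x₀ (inj₂ (3+x₀≤i , bl)) = below-absent A i x₀ bl (≤-trans (n≤1+n _) (≤-trans (n≤1+n _) 3+x₀≤i))

freeSide-far : ∀ {n} (A : Subset n) i x₀ → FreeSide A i x₀ → FarPair i x₀
freeSide-far A i x₀ (inj₁ (2+i≤x₀ , _)) = inj₂ 2+i≤x₀
freeSide-far A i x₀ (inj₂ (3+x₀≤i , _)) = inj₁ 3+x₀≤i

-- A pair on a free side of an interior isolated point occupies that side: the
-- weight rises by one while miss drops by two, so the cost drops by one.
freeSide-escape : ∀ {n} k (A : Subset n) i x₀ → suc x₀ < n → Isolated A i → FreeSide A i x₀ → Interior n i →
  suc k + 3 < cost A i → Escape A i k
freeSide-escape {n} k A i x₀ fits iso free int big =
  pairEscape k A i x₀ x₀ fits iso far x₀∈P x₀∉A big lose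
  where
    P = pair n x₀
    C = A ∪ P
    far = freeSide-far A i x₀ free
    x₀∈P = pair-left n x₀ fits
    x₀∈C = ⊑-∪ʳ A P x₀ x₀∈P
    x₀∉A = freeSide-new A i x₀ free
    gain : FreeSide A i x₀ → suc (sides A i) ≤ sides C i
    gain (inj₁ (2+i≤x₀ , ab)) rewrite ab | above-intro C i x₀ (≤-trans (n≤1+n _) 2+i≤x₀) x₀∈C = begin
      suc (ind (below A i) + 0)   ≡⟨ cong suc (+-identityʳ _) ⟩
      suc (ind (below A i))       ≡⟨ +-comm 1 _ ⟩
      ind (below A i) + 1         ≤⟨ +-monoˡ-≤ 1 (ind-mono (below-mono A C i (⊑-∪ˡ A P))) ⟩
      ind (below C i) + 1 ∎
      where open ≤-Reasoning
    gain (inj₂ (3+x₀≤i , bl)) rewrite bl | below-intro C x₀ i (≤-trans (n≤1+n _) (≤-trans (n≤1+n _) 3+x₀≤i)) x₀∈C =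
      s≤s (ind-mono (above-mono A C i (⊑-∪ˡ A P)))
    lose : cost A i ≤ suc (cost C i)
    lose = begin
      weight A i + miss A                    ≡⟨ cong (_+ miss A) (weight-interior i int A) ⟩
      sides A i + miss A                 ≤⟨ +-monoʳ-≤ (sides A i) (miss-∪-fromList A (x₀ ∷ suc x₀ ∷ [])) ⟩
      sides A i + (miss C + 2)           ≡⟨ shift (sides A i) (miss C) ⟩
      suc (sides A i) + suc (miss C)     ≤⟨ +-monoˡ-≤ (suc (miss C)) (gain free) ⟩
      sides C i + suc (miss C)           ≡⟨ +-suc (sides C i) (miss C) ⟩
      suc (sides C i + miss C)           ≡⟨ cong (λ c → suc (c + miss C)) (sym (weight-interior i int C)) ⟩
      suc (weight C i + miss C) ∎
      where
        open ≤-Reasoning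
        shift : ∀ s m → s + (m + 2) ≡ suc s + suc m
        shift = solve-∀

lonely-bound : ∀ k n m c → suc k + 4 ≤ n → n ≤ m + 3 → 2 ≤ c → k + 3 < c + m
lonely-bound k n m c room n≤m+3 2≤c = begin
  suc (k + 3)   ≡⟨ shift k ⟩
  2 + (k + 2)   ≤⟨ +-mono-≤ 2≤c (+-cancelʳ-≤ 3 (k + 2) m (≤-trans (≤-reflexive (shift′ k)) (≤-trans room n≤m+3))) ⟩
  c + m ∎
  where
    open ≤-Reasoning
    shift : ∀ k → suc (k + 3) ≡ 2 + (k + 2)
    shift = solve-∀
    shift′ : ∀ k → (k + 2) + 3 ≡ suc k + 4
    shift′ = solve-∀

-- A pair on a free side of a point alone in A: for an interior point this is a
-- free-side escape, otherwise the weight stays at least 2 and the union has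
-- only three points, so the cost stays at least n - 1.
lonely-pair-escape : ∀ {n} k (A : Subset n) i x₀ → suc k + 4 ≤ n → suc x₀ < n → Isolated A i →
  below A i ≡ false → above A i ≡ false → FreeSide A i x₀ → suc k + 3 < cost A i → Escape A i k
lonely-pair-escape {n} k A i x₀ room fits iso bl ab free big with interior? n i
... | yes int    = freeSide-escape k A i x₀ fits iso free int big
... | no notInt = escape x₀ x₀ fits (pair-left n x₀ fits) (freeSide-new A i x₀ free)
                    (farPair-isolated A i x₀ iso (freeSide-far A i x₀ free))
                    (lonely-bound k n (miss C) (weight C i) room three (proj₂ (weight-boundary i (mem⇒< A i (proj₁ iso)) notInt) C))
  where
    P = pair n x₀
    C = A ∪ P
    L = i ∷ x₀ ∷ suc x₀ ∷ []
    C⊑L : C ⊑ fromList n L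
    C⊑L m e with ∪-split A P m e
    ... | inj₁ mA = fromList-mem n L m (here (mem-sing n i m (no-sides⇒⊑sing A i bl ab m mA))) (mem⇒< A m mA)
    ... | inj₂ mP = fromList-mem n L m ([ (λ q → there (here q)) , (λ q → there (there (here q))) ]′ (mem-pair n x₀ m mP))
                      (mem⇒< P m mP)
    three : n ≤ miss C + 3
    three = inside-fromList C L C⊑L

-- a point alone in A: place a pair to its right if there is room, else to its left
lonely-escape : ∀ {n} k (A : Subset n) i → 6 ≤ n → suc k + 4 ≤ n → Isolated A i →
  below A i ≡ false → above A i ≡ false → suc k + 3 < cost A i → Escape A i k
lonely-escape {n} k A i six room iso bl ab big with suc (suc (suc (suc i))) ≤? n
... | yes 4+i≤n = lonely-pair-escape k A i (suc (suc i)) room 4+i≤n iso bl ab (inj₁ (≤-refl , ab)) big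
... | no tight with m≤n⇒∃[o]m+o≡n (+-cancelˡ-≤ 3 3 i (≤-trans six (≤-pred (≰⇒> tight))))
...   | x₀ , refl = lonely-pair-escape k A (3 + x₀) x₀ room fits iso bl ab (inj₂ (≤-refl , bl)) big
  where fits = <-trans (<-trans (n<1+n (suc x₀)) (n<1+n (suc (suc x₀)))) (mem⇒< A (3 + x₀) (proj₁ iso))

tooCheap : ∀ k c → suc k + 3 < c → c ≤ 4 → ⊥
tooCheap k c big c≤4 = <⇒≱ big (≤-trans c≤4 (subst (4 ≤_) (+-suc k 3) (m≤n+m 4 k)))

-- Without growth points and with both sides occupied, A misses only i ± 1.
both-sides-cost : ∀ {n} (A : Subset n) i → NoGrowth A i → Isolated A i → below A i ≡ true → above A i ≡ true →
  cost A i ≤ 4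
both-sides-cost {n} A i none iso bl ab with below-elim A i bl | above-elim A i ab
... | a , a<i , _ | b , i<b , bA = +-mono-≤ (weight≤2 A i (≤-<-trans z≤n a<i) (≤-<-trans i<b (mem⇒< A b bA)))
                                     (cover A (pred i ∷ suc i ∷ []) covered)
  where
    covered : ∀ m → m < n → mem A m ≡ false → m ∈ₗ (pred i ∷ suc i ∷ [])
    covered m m<n mA with noGrowth-missing A i none iso m m<n mA
    ... | inj₁ 1+m≡i                = here (cong pred 1+m≡i)
    ... | inj₂ (inj₁ m≡1+i)         = there (here m≡1+i)
    ... | inj₂ (inj₂ (inj₁ (_ , f))) = ⊥-elim (true≢false bl f)
    ... | inj₂ (inj₂ (inj₂ (_ , f))) = ⊥-elim (true≢false ab f)

-- Only the left side occupied: a pair to the right escapes when there is room;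
-- otherwise i is within distance 2 of the end and costs exactly 4.
rightFree-escape : ∀ {n} k (A : Subset n) i → NoGrowth A i → Isolated A i → below A i ≡ true → above A i ≡ false →
  suc k + 3 < cost A i → Escape A i k
rightFree-escape {n} k A i none iso bl ab big with below-elim A i bl
... | a , a<i , aA with suc (suc (suc (suc i))) ≤? n
...   | yes room = freeSide-escape k A i (suc (suc i)) room iso (inj₁ (≤-refl , ab)) (2≤i , ≤-trans (n≤1+n _) room) big
  where 2≤i = ≤-trans (s≤s (s≤s z≤n)) (left-gap A i a iso a<i aA)
...   | no tight = ⊥-elim (tooCheap k (cost A i) big (tight-cost (mem⇒< A i (proj₁ iso)) (≤-pred (≰⇒> tight))))
  where
    2≤i = ≤-trans (s≤s (s≤s z≤n)) (left-gap A i a iso a<i aA)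
    missing : ∀ m → m < n → mem A m ≡ false → m ≡ pred i ⊎ i < m
    missing m m<n mA with noGrowth-missing A i none iso m m<n mA
    ... | inj₁ 1+m≡i                  = inj₁ (cong pred 1+m≡i)
    ... | inj₂ (inj₁ refl)            = inj₂ (n<1+n i)
    ... | inj₂ (inj₂ (inj₁ (_ , f)))   = ⊥-elim (true≢false bl f)
    ... | inj₂ (inj₂ (inj₂ (i<m , _))) = inj₂ i<m
    tight-cost : i < n → n ≤ 3 + i → cost A i ≤ 4
    tight-cost i<n n≤3+i with m≤n⇒m<n∨m≡n i<n
    ... | inj₂ refl = +-mono-≤ (weight≤3 A i) (cover A (pred i ∷ []) (λ m m<n mA →
            [ (λ q → here q) , (λ i<m → ⊥-elim (<⇒≱ m<n i<m)) ]′ (missing m m<n mA)))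
    ... | inj₁ 1+i<n with m≤n⇒m<n∨m≡n 1+i<n
    ...   | inj₂ refl = +-mono-≤ (weight≤2 A i (≤-trans (s≤s z≤n) 2≤i) 1+i<n) (cover A (pred i ∷ suc i ∷ []) (λ m m<n mA →
              [ (λ q → here q) , (λ i<m → there (here (≤-antisym (≤-pred m<n) i<m))) ]′ (missing m m<n mA)))
    ...   | inj₁ 2+i<n with ≤-antisym n≤3+i 2+i<n
    ...     | refl = +-mono-≤ (≤-reflexive (trans (weight-interior i (2≤i , ≤-refl) A) (cong₂ (λ l r → ind l + ind r) bl ab)))
                       (cover A (pred i ∷ suc i ∷ suc (suc i) ∷ []) (λ m m<n mA →
                         [ (λ q → here q) , (λ i<m → there (tail m i<m m<n)) ]′ (missing m m<n mA)))
      where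
        tail : ∀ m → i < m → m < 3 + i → m ∈ₗ (suc i ∷ suc (suc i) ∷ [])
        tail m i<m m<3+i with m ≟ suc i
        ... | yes q = here q
        ... | no q  = there (here (≤-antisym (≤-pred m<3+i) (≤∧≢⇒< i<m (≢-sym q))))

-- Only the right side occupied: a pair to the left escapes when there is room;
-- otherwise i ≤ 2 and i costs exactly 4.
leftFree-escape : ∀ {n} k (A : Subset n) i → 6 ≤ n → NoGrowth A i → Isolated A i → below A i ≡ false → above A i ≡ true →
  suc k + 3 < cost A i → Escape A i k
leftFree-escape {n} k A i six none iso bl ab big with above-elim A i ab
... | b , i<b , bA with 3 ≤? i
...   | yes 3≤i with m≤n⇒∃[o]m+o≡n 3≤i
...     | x₀ , refl = freeSide-escape k A (3 + x₀) x₀ fits iso (inj₂ (≤-refl , bl)) (s≤s (s≤s z≤n) , 3+i≤n) big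
  where
    3+i≤n = ≤-trans (s≤s (right-gap A (3 + x₀) b iso i<b bA)) (mem⇒< A b bA)
    fits = <-trans (<-trans (n<1+n (suc x₀)) (n<1+n (suc (suc x₀)))) (mem⇒< A (3 + x₀) (proj₁ iso))
leftFree-escape {n} k A i six none iso bl ab big | b , i<b , bA | no small =
  ⊥-elim (tooCheap k (cost A i) big (small-cost i refl (≤-pred (≰⇒> small))))
  where
    missing : ∀ m → m < n → mem A m ≡ false → m < i ⊎ m ≡ suc i
    missing m m<n mA with noGrowth-missing A i none iso m m<n mA
    ... | inj₁ 1+m≡i                  = inj₁ (subst (m <_) 1+m≡i ≤-refl)
    ... | inj₂ (inj₁ m≡1+i)           = inj₂ m≡1+i
    ... | inj₂ (inj₂ (inj₁ (m<i , _))) = inj₁ m<i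
    ... | inj₂ (inj₂ (inj₂ (_ , f)))   = ⊥-elim (true≢false ab f)
    small-cost : ∀ j → j ≡ i → j ≤ 2 → cost A i ≤ 4
    small-cost 0 refl _ = +-mono-≤ (weight≤3 A 0) (cover A (1 ∷ []) (λ m m<n mA →
      [ (λ ()) , here ]′ (missing m m<n mA)))
    small-cost 1 refl _ = +-mono-≤ (weight≤2 A 1 (s≤s z≤n) (≤-trans (s≤s (s≤s (s≤s z≤n))) six)) (cover A (0 ∷ 2 ∷ []) (λ m m<n mA →
      [ (λ { (s≤s z≤n) → here refl }) , (λ q → there (here q)) ]′ (missing m m<n mA)))
    small-cost 2 refl _ =
      +-mono-≤ (≤-reflexive (trans (weight-interior 2 (≤-refl , ≤-trans (n≤1+n 5) six) A) (cong₂ (λ l r → ind l + ind r) bl ab)))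
        (cover A (0 ∷ 1 ∷ 3 ∷ []) (λ m m<n mA →
          [ (λ { (s≤s z≤n) → here refl ; (s≤s (s≤s z≤n)) → there (here refl) }) , (λ q → there (there (here q))) ]′
            (missing m m<n mA)))
    small-cost (suc (suc (suc _))) _ (s≤s (s≤s ()))

escape-from : ∀ {n} k (A : Subset n) i → 6 ≤ n → suc k + 4 ≤ n → Isolated A i → suc k + 3 < cost A i → Escape A i k
escape-from {n} k A i six room iso big with search (GrowthPoint A i) (growthPoint? A i) n
... | inj₁ (x , x<n , growth) = growth-escape k A i x x<n iso growth big
... | inj₂ none with boolCases (below A i) | boolCases (above A i)
...   | inj₁ bl | inj₁ ab = ⊥-elim (tooCheap k (cost A i) big (both-sides-cost A i none iso bl ab))
...   | inj₁ bl | inj₂ ab = rightFree-escape k A i none iso bl ab big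
...   | inj₂ bl | inj₁ ab = leftFree-escape k A i six none iso bl ab big
...   | inj₂ bl | inj₂ ab = lonely-escape k A i six room iso bl ab big

expensive⇒∉G : ∀ n → 6 ≤ n → ∀ k → k + 4 ≤ n → ∀ A i → Isolated A i → k + 3 < cost A i → ¬ G n k A
expensive⇒∉G n six zero    _    A i iso _   = isolated⇒∉F A i iso
expensive⇒∉G n six (suc k) room A i iso big with escape-from k A i six room iso big
... | escape x₀ x fits xP xA iso′ big′ =
  upperStep n k A (pair n x₀) x (F⊆G n (≤-trans (s≤s (s≤s z≤n)) six) k (pair n x₀) (pair-F n x₀ fits)) xP xA
    (expensive⇒∉G n six k (≤-trans (n≤1+n _) room) (A ∪ pair n x₀) i iso′ big′)

-- At level 0 there are no
-- isolated points (each costs at least 4); at level k + 1 the lower step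
-- applies, since members of G k obey the bound at level k by the upper bound.
cheap⇒G : ∀ n → 6 ≤ n → ∀ k → k + 4 ≤ n → ∀ A → Nonempty A → CostBound A k → G n k A
cheap⇒G n six zero _ A ne bound =
  noIsolated⇒F A (nonempty⇒mem ne) (λ i iso → <⇒≱ (isolated-cost≥4 (≤-trans (s≤s (s≤s z≤n)) six) A i iso) (bound i iso))
cheap⇒G n six (suc k) room A ne bound = lowerStep n (≤-trans (s≤s (s≤s z≤n)) six) k A ne grow
  where
    room′ = ≤-trans (n≤1+n _) room
    grow : ∀ B x → G n k B → mem B x ≡ true → mem A x ≡ false → G n k (A ∪ B)
    grow B x B∈G xB xA = cheap⇒G n six k room′ (A ∪ B) (mem⇒nonempty (A ∪ B) x (⊑-∪ʳ A B x xB))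
                           (costBound-∪ k A B x xB xA bound boundB)
      where
        boundB : CostBound B k
        boundB i iso = ≮⇒≥ (λ big → expensive⇒∉G n six k room′ B i iso big B∈G)

nonempty-miss : ∀ {n} (A : Subset n) → Nonempty A → miss A ≤ n ∸ 1
nonempty-miss A ne with nonempty⇒mem ne
... | m , mA = m+n≤o⇒m≤o∸n (miss A) (members A (m ∷ []) ([] ∷ []) λ { _ (here refl) → mA })

-- With k = n - 4 = 2 + m: the middle
-- singleton {3} lies in G k by the lower bound, while 0 is isolated in {0,3,4}
-- at cost n > k + 3.  Two upper steps, with the pair {3,4} ∈ F and with
-- {3} ∈ G k, climb back to {0}.
endSingleton∉G′ : ∀ m → ¬ G (6 + m) (4 + m) (sing (6 + m) 0)
endSingleton∉G′ m = upperStep n (3 + m) S₀ S₃ 3 S₃∈G refl refl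
                      (upperStep n (2 + m) (S₀ ∪ S₃) P 4 (F⊆G n 2≤n (2 + m) P (pair-F n 3 (≤-trans (n≤1+n 5) six)))
                        refl refl C∉G)
  where
    n = 6 + m
    six : 6 ≤ n
    six = s≤s (s≤s (s≤s (s≤s (s≤s (s≤s z≤n)))))
    2≤n = s≤s (s≤s z≤n)
    S₀ = sing n 0
    S₃ = sing n 3
    P  = pair n 3
    C  = (S₀ ∪ S₃) ∪ P
    room : (2 + m) + 4 ≤ n
    room = ≤-reflexive (+-comm (2 + m) 4)
    S₃-bound : CostBound S₃ (2 + m)
    S₃-bound i (iS , _) with mem-sing n 3 i iS
    ... | refl = subst (_≤ (2 + m) + 3) (sym (cong (_+ miss S₃) (weight-interior 3 (s≤s (s≤s z≤n) , six) S₃)))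
                   (subst (sides S₃ 3 + miss S₃ ≤_) (shift m) (≤-pred (occupied-count S₃ 3 refl)))
      where
        shift : ∀ m → 5 + m ≡ (2 + m) + 3
        shift = solve-∀
    S₃∈G : G n (3 + m) S₃
    S₃∈G = G-mono n 2≤n {2 + m} {3 + m} S₃ (n≤1+n _) (cheap⇒G n six (2 + m) room S₃ (mem⇒nonempty S₃ 3 refl) S₃-bound)
    L = 0 ∷ 3 ∷ 4 ∷ []
    C⊑L : C ⊑ fromList n L
    C⊑L t e with ∪-split (S₀ ∪ S₃) P t e
    ... | inj₂ tP = fromList-mem n L t ([ (λ q → there (here q)) , (λ q → there (there (here q))) ]′ (mem-pair n 3 t tP)) (mem⇒< P t tP)
    ... | inj₁ t₀₃ with ∪-split S₀ S₃ t t₀₃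
    ...   | inj₁ t₀ = fromList-mem n L t (here (mem-sing n 0 t t₀)) (mem⇒< S₀ t t₀)
    ...   | inj₂ t₃ = fromList-mem n L t (there (here (mem-sing n 3 t t₃))) (mem⇒< S₃ t t₃)
    C∉G : ¬ G n (2 + m) C
    C∉G = expensive⇒∉G n six (2 + m) room C 0 (refl , refl , refl)
            (≤-trans (≤-reflexive (shift m)) (subst (n ≤_) (+-comm (miss C) 3) (inside-fromList C L C⊑L)))
      where
        shift : ∀ m → suc ((2 + m) + 3) ≡ 6 + m
        shift = solve-∀

endSingleton∉G : ∀ n → 6 ≤ n → ¬ G n (n ∸ 2) (sing n 0)
endSingleton∉G n six with m≤n⇒∃[o]m+o≡n six
... | m , refl = endSingleton∉G′ m

corollary3 : ∀ n → 6 ≤ n → IsDense (pathFamily n) (n ∸ 1)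
corollary3 n six = everything , notBefore
  where
    2≤n = ≤-trans (s≤s (s≤s z≤n)) six
    -- every nonempty set misses at most n - 1 positions, hence lies in G (n - 1)
    everything : closureIter (n ∸ 1) (pathFamily n) ≋ AllNonempty n
    everything A = G-nonempty n 2≤n (n ∸ 1) A , λ ne → fewMissing⇒G n 2≤n (n ∸ 1) A ne (nonempty-miss A ne)
    -- G j ⊆ G (n - 2) omits the nonempty set {0} for every j < n - 1
    notBefore : ∀ j → j < n ∸ 1 → ¬ (closureIter j (pathFamily n) ≋ AllNonempty n)
    notBefore j j<n-1 same =
      endSingleton∉G n six (G-mono n 2≤n {j} {n ∸ 2} (sing n 0) (subst (j ≤_) (pred[m∸n]≡m∸[1+n] n 1) (<⇒≤pred j<n-1))
        (proj₂ (same (sing n 0)) (mem⇒nonempty (sing n 0) 0 (mem-sing-self n 0 (≤-trans (s≤s z≤n) six)))))
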